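{- Let $p\ge 3$ be a prime, $m$ a nonzero integer, and define integers $d_m(n)$ by $$\frac{1}{(1-x)^{m}}\prod_{i=0}^{\infty}\frac{1}{(1-x^{p^{i}})^{(p-1)m}}=\sum_{n=0}^{\infty}d_{m}(n)x^{n}.$$ Let $n\ge 1$ be an integer with base-$p$ expansion $n=n_sp^s+\dots+n_tp^t$, where $s\le t$, $n_j\in\{0,\dots,p-1\}$ and $n_s\neq 0$. Then $$d_m(n)\equiv pm\cdot\left(n_s^{ -1}\bmod p\right)\pmod{p^{\nu_p(m)+2}},$$ where $n_s^{ -1}\bmod p\in\{1,\dots,p-1\}$ is the inverse of $n_s$ modulo $p$. In particular $\nu_p(d_m(n))=0$ if $n=0$ and $\nu_p(d_m(n))=\nu_p(m)+1$ if $n\ge1$, and the sequence $\left(\frac{d_m(n)}{pm}\bmod p\right)_{n\ge1}$ does not depend on $m$.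
   Context: $\nu_p$ denotes the $p$-adic valuation. For $n\ge1$, $d_m(n)/(pm)$ is a rational number with denominator prime to $p$, and "$\bmod p$" means its image in $\mathbb{Z}/p\mathbb{Z}$. -}

module Defs where

open import Data.Nat as ℕ using (ℕ; zero; suc; _∸_; _^_)
open import Data.Nat.Divisibility using (_∣?_)
open import Data.Integer using (ℤ; +_; -[1+_]; _+_; _*_; _-_; -_; 0ℤ; 1ℤ)
open import Data.Integer.Divisibility using (_∣_)
open import Data.Bool using (if_then_else_)
open import Relation.Nullary using (¬_; does)

Series : Set
Series = ℕ → ℤ

Σ< : (ℕ → ℤ) → ℕ → ℤ
Σ< f zero = 0ℤ
Σ< f (suc n) = Σ< f n + f n

_⊛_ : Series → Series → Series
(f ⊛ g) n = Σ< (λ i → f i * g (n ∸ i)) (suc n)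

one : Series
one zero = 1ℤ
one (suc n) = 0ℤ

-- the series 1 - x^k  (used with k ≥ 1)
oneMinus : ℕ → Series
oneMinus k zero = 1ℤ
oneMinus k (suc n) = if does (k ℕ.≟ suc n) then - 1ℤ else 0ℤ

-- the series 1/(1 - x^k) = Σ_j x^{jk}  (used with k ≥ 1)
geom : ℕ → Series
geom k n = if does (k ∣? n) then 1ℤ else 0ℤ

pow : Series → ℕ → Series
pow f zero = one
pow f (suc e) = pow f e ⊛ f

-- (1 - x^k)^(-e) for e : ℤ
invPow : ℕ → ℤ → Series
invPow k (+ e) = pow (geom k) e
invPow k -[1+ j ] = pow (oneMinus k) (suc j)

prodTo : ℕ → ℤ → ℕ → Series
prodTo p m zero = one
prodTo p m (suc N) = prodTo p m N ⊛ invPow (p ^ N) (+ (p ∸ 1) * m)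

-- Only factors with p^i ≤ n affect the coefficient of x^n; for p ≥ 2 these
-- all have i ≤ n, so truncating the product at i ≤ n is exact.
d : ℕ → ℤ → ℕ → ℤ
d p m n = (invPow 1 m ⊛ prodTo p m (suc n)) n

_≡_[mod_] : ℤ → ℤ → ℕ → Set
a ≡ b [mod q ] = (+ q) ∣ (a - b)

Val : ℕ → ℕ → ℤ → Set
Val p v x = ((+ (p ^ v)) ∣ x) × ¬ ((+ (p ^ suc v)) ∣ x)
  where open import Data.Product using (_×_)

-- Let F = (1 - x)⁻¹ Π_{i≥0} (1 - x^(p^i))^(-(p-1)), so that Σ d_m(n) xⁿ = F^m. Multiplying by
-- 1 - x^(p^N) telescopes F into Π_{i<N} φ(x^(p^i)) with φ(y) = (1 - y^p) / (1 - y)^p. As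
-- (1 - y)^p = (1 - y^p) + p B(y), where B_j = (-1)^j C(p,j) / p for 0 < j < p, the inverse
-- φ = 1 / (1 + p B(y) / (1 - y^p)) is 1 + p g(y) modulo p², with g_j = -B_(j mod p). Hence F ≡ 1 + p S
-- modulo p² and x^(p^N), where S = Σ_i g(x^(p^i)), and for p odd the binomial theorem gives
-- (1 + p S)^m ≡ 1 + p m S modulo p^(ν_p(m)+2). At n = p^s (n_s + p q) only the term i = s of S
-- survives, so S_n = -B_(n_s); and j B_j = -(-1)^(j-1) C(p-1,j-1) ≡ -1 (mod p), so S_n ≡ n_s⁻¹.
-- The valuation and the independence of m follow because S_n is a unit modulo p.

module Submission where

open import Data.Nat.Base using (ℕ; suc)
open import Data.Nat.Primality using (Prime)

module PowerSeries where

  open import Defs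
  open import Data.Nat as ℕ using (ℕ; zero; suc; _∸_; z≤n; s≤s; _^_)
  import Data.Nat.Properties as ℕP
  import Data.Nat.Divisibility as ℕD
  open import Data.Integer as ℤ using (ℤ; +_; _+_; _*_; _-_; -_; 0ℤ; 1ℤ)
  import Data.Integer.Properties as ℤP
  open import Data.Integer.Divisibility.Signed as ℤD using (divides) renaming (_∣_ to _∣ℤ_)
  open import Data.Integer.Tactic.RingSolver using (solve-∀)
  open import Data.Nat.Tactic.RingSolver using () renaming (solve-∀ to ℕ-solve-∀)
  open import Algebra.Properties.CommutativeSemigroup ℤP.+-commutativeSemigroup using (interchange)
  open import Algebra.Properties.CommutativeSemigroup ℕP.*-commutativeSemigroup using (x∙yz≈y∙xz)
  open import Algebra.Structures using (IsCommutativeRing)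
  open import Algebra.Bundles using (CommutativeRing)
  import Algebra.Solver.Ring.AlmostCommutativeRing as ACR
  import Algebra.Solver.Ring as RingSolver
  import Relation.Binary.Reasoning.Setoid
  open import Data.Bool using (if_then_else_)
  open import Data.Maybe using (Maybe; just; nothing)
  open import Data.Product using (Σ-syntax; _,_; proj₁; proj₂)
  open import Data.Empty using (⊥-elim)
  open import Relation.Nullary using (Dec; yes; no; ¬_)
  open import Relation.Nullary.Decidable using (dec-true; dec-false)
  open import Function using (_∘_)
  open import Relation.Binary.PropositionalEquality

  Σ<-cong : ∀ {f g : ℕ → ℤ} n → (∀ i → i ℕ.< n → f i ≡ g i) → Σ< f n ≡ Σ< g n
  Σ<-cong zero eq = refl
  Σ<-cong (suc n) eq = cong₂ _+_ (Σ<-cong n (λ i i<n → eq i (ℕP.m<n⇒m<1+n i<n))) (eq n ℕP.≤-refl)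

  Σ<-zero : ∀ {f : ℕ → ℤ} n → (∀ i → i ℕ.< n → f i ≡ 0ℤ) → Σ< f n ≡ 0ℤ
  Σ<-zero zero _ = refl
  Σ<-zero (suc n) z = cong₂ _+_ (Σ<-zero n (λ i i<n → z i (ℕP.m<n⇒m<1+n i<n))) (z n ℕP.≤-refl)

  Σ<-single : ∀ {f : ℕ → ℤ} a n → (∀ i → i ≢ a → f i ≡ 0ℤ) → a ℕ.< n → Σ< f n ≡ f a
  Σ<-single {f} a (suc n) z a<1+n with a ℕ.≟ n
  ... | yes refl = trans (cong (_+ f a) (Σ<-zero a (λ i i<a → z i (ℕP.<⇒≢ i<a)))) (ℤP.+-identityˡ (f a))
  ... | no a≢n = trans (cong₂ _+_ (Σ<-single a n z (ℕP.≤∧≢⇒< (ℕP.≤-pred a<1+n) a≢n)) (z n (a≢n ∘ sym)))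
                       (ℤP.+-identityʳ (f a))

  Σ<-distrib-+ : ∀ (f g : ℕ → ℤ) n → Σ< (λ i → f i + g i) n ≡ Σ< f n + Σ< g n
  Σ<-distrib-+ f g zero = refl
  Σ<-distrib-+ f g (suc n) =
    trans (cong (_+ (f n + g n)) (Σ<-distrib-+ f g n)) (interchange (Σ< f n) (Σ< g n) (f n) (g n))

  *-distribˡ-Σ< : ∀ c (f : ℕ → ℤ) n → Σ< (λ i → c * f i) n ≡ c * Σ< f n
  *-distribˡ-Σ< c f zero = sym (ℤP.*-zeroʳ c)
  *-distribˡ-Σ< c f (suc n) =
    trans (cong (_+ c * f n) (*-distribˡ-Σ< c f n)) (sym (ℤP.*-distribˡ-+ c (Σ< f n) (f n)))

  *-distribʳ-Σ< : ∀ c (f : ℕ → ℤ) n → Σ< (λ i → f i * c) n ≡ Σ< f n * c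
  *-distribʳ-Σ< c f n = begin
    Σ< (λ i → f i * c) n ≡⟨ Σ<-cong n (λ i _ → ℤP.*-comm (f i) c) ⟩
    Σ< (λ i → c * f i) n ≡⟨ *-distribˡ-Σ< c f n ⟩
    c * Σ< f n           ≡⟨ ℤP.*-comm c (Σ< f n) ⟩
    Σ< f n * c           ∎
    where open ≡-Reasoning

  Σ<-head : ∀ (f : ℕ → ℤ) n → Σ< f (suc n) ≡ f 0 + Σ< (λ i → f (suc i)) n
  Σ<-head f zero = trans (ℤP.+-identityˡ (f 0)) (sym (ℤP.+-identityʳ (f 0)))
  Σ<-head f (suc n) = trans (cong (_+ f (suc n)) (Σ<-head f n)) (ℤP.+-assoc (f 0) _ _)

  Σ<-reverse : ∀ (f : ℕ → ℤ) n → Σ< f n ≡ Σ< (λ i → f (n ∸ suc i)) n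
  Σ<-reverse f zero = refl
  Σ<-reverse f (suc n) = begin
    Σ< f n + f n                          ≡⟨ ℤP.+-comm (Σ< f n) (f n) ⟩
    f n + Σ< f n                          ≡⟨ cong (λ z → f n + z) (Σ<-reverse f n) ⟩
    f n + Σ< (λ i → f (n ∸ suc i)) n      ≡⟨ Σ<-head (λ i → f (n ∸ i)) n ⟨
    Σ< (λ i → f (n ∸ i)) (suc n)          ∎
    where open ≡-Reasoning

  Σ<-triangle : ∀ (F : ℕ → ℕ → ℤ) N →
    Σ< (λ i → Σ< (λ j → F j i) (suc i)) N ≡ Σ< (λ j → Σ< (λ k → F j (j ℕ.+ k)) (N ∸ j)) N
  Σ<-triangle F zero = refl
  Σ<-triangle F (suc N) = begin
    Σ< (λ i → Σ< (λ j → F j i) (suc i)) N + Σ< (λ j → F j N) (suc N)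
      ≡⟨ cong (_+ Σ< (λ j → F j N) (suc N)) (Σ<-triangle F N) ⟩
    Rows N N + Σ< (λ j → F j N) (suc N)
      ≡⟨ cong (_+ Σ< (λ j → F j N) (suc N)) (sym lastRowEmpty) ⟩
    Rows N (suc N) + Σ< (λ j → F j N) (suc N)
      ≡⟨ Σ<-distrib-+ (λ j → Σ< (λ k → F j (j ℕ.+ k)) (N ∸ j)) (λ j → F j N) (suc N) ⟨
    Σ< (λ j → Σ< (λ k → F j (j ℕ.+ k)) (N ∸ j) + F j N) (suc N)
      ≡⟨ Σ<-cong (suc N) extendRow ⟩
    Rows (suc N) (suc N) ∎
    where
    open ≡-Reasoning
    Rows : ℕ → ℕ → ℤ
    Rows M = Σ< (λ j → Σ< (λ k → F j (j ℕ.+ k)) (M ∸ j))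
    lastRowEmpty : Rows N (suc N) ≡ Rows N N
    lastRowEmpty = trans (cong (λ z → Rows N N + Σ< (λ k → F N (N ℕ.+ k)) z) (ℕP.n∸n≡0 N)) (ℤP.+-identityʳ _)
    extendRow : ∀ j → j ℕ.< suc N →
      Σ< (λ k → F j (j ℕ.+ k)) (N ∸ j) + F j N ≡ Σ< (λ k → F j (j ℕ.+ k)) (suc N ∸ j)
    extendRow j (s≤s j≤N) rewrite ℕP.+-∸-assoc 1 j≤N | ℕP.m+[n∸m]≡n j≤N = refl

  -- The ring of formal power series

  infix 4 _≐_
  _≐_ : Series → Series → Set
  f ≐ g = ∀ n → f n ≡ g n

  infixl 6 _⊕_
  _⊕_ : Series → Series → Series
  (f ⊕ g) n = f n + g n

  ⊖_ : Series → Series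
  (⊖ f) n = - f n

  𝟘 : Series
  𝟘 _ = 0ℤ

  const : ℤ → Series
  const a zero = a
  const a (suc n) = 0ℤ

  𝟙 : Series
  𝟙 = const 1ℤ

  one≐𝟙 : one ≐ 𝟙
  one≐𝟙 zero = refl
  one≐𝟙 (suc n) = refl

  const-⊛ : ∀ a f → const a ⊛ f ≐ λ n → a * f n
  const-⊛ a f n = begin
    Σ< (λ i → const a i * f (n ∸ i)) (suc n)      ≡⟨ Σ<-head _ n ⟩
    a * f n + Σ< (λ i → 0ℤ * f (n ∸ suc i)) n
      ≡⟨ cong (λ z → a * f n + z) (Σ<-zero n (λ i _ → ℤP.*-zeroˡ (f (n ∸ suc i)))) ⟩
    a * f n + 0ℤ                                  ≡⟨ ℤP.+-identityʳ (a * f n) ⟩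
    a * f n                                       ∎
    where open ≡-Reasoning

  ⊛-cong : ∀ {f f′ g g′} → f ≐ f′ → g ≐ g′ → f ⊛ g ≐ f′ ⊛ g′
  ⊛-cong f≐f′ g≐g′ n = Σ<-cong (suc n) (λ i _ → cong₂ _*_ (f≐f′ i) (g≐g′ (n ∸ i)))

  ⊛-identityˡ : ∀ f → one ⊛ f ≐ f
  ⊛-identityˡ f n = trans (⊛-cong {g = f} one≐𝟙 (λ _ → refl) n) (trans (const-⊛ 1ℤ f n) (ℤP.*-identityˡ (f n)))

  ⊛-comm : ∀ f g → f ⊛ g ≐ g ⊛ f
  ⊛-comm f g n = begin
    Σ< (λ i → f i * g (n ∸ i)) (suc n)              ≡⟨ Σ<-reverse _ (suc n) ⟩
    Σ< (λ i → f (n ∸ i) * g (n ∸ (n ∸ i))) (suc n)  ≡⟨ Σ<-cong (suc n) swap ⟩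
    Σ< (λ i → g i * f (n ∸ i)) (suc n)              ∎
    where
    open ≡-Reasoning
    swap : ∀ i → i ℕ.< suc n → f (n ∸ i) * g (n ∸ (n ∸ i)) ≡ g i * f (n ∸ i)
    swap i (s≤s i≤n) = trans (cong (λ j → f (n ∸ i) * g j) (ℕP.m∸[m∸n]≡n i≤n)) (ℤP.*-comm (f (n ∸ i)) (g i))

  ⊛-distribˡ-⊕ : ∀ f g h → f ⊛ (g ⊕ h) ≐ (f ⊛ g) ⊕ (f ⊛ h)
  ⊛-distribˡ-⊕ f g h n =
    trans (Σ<-cong (suc n) (λ i _ → ℤP.*-distribˡ-+ (f i) (g (n ∸ i)) (h (n ∸ i)))) (Σ<-distrib-+ _ _ (suc n))

  ⊛-assoc : ∀ f g h → (f ⊛ g) ⊛ h ≐ f ⊛ (g ⊛ h)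
  ⊛-assoc f g h n = begin
    Σ< (λ i → Σ< (λ j → f j * g (i ∸ j)) (suc i) * h (n ∸ i)) (suc n)
      ≡⟨ Σ<-cong (suc n) (λ i _ → sym (*-distribʳ-Σ< (h (n ∸ i)) (λ j → f j * g (i ∸ j)) (suc i))) ⟩
    Σ< (λ i → Σ< (λ j → f j * g (i ∸ j) * h (n ∸ i)) (suc i)) (suc n)
      ≡⟨ Σ<-triangle (λ j i → f j * g (i ∸ j) * h (n ∸ i)) (suc n) ⟩
    Σ< (λ j → Σ< (λ k → f j * g (j ℕ.+ k ∸ j) * h (n ∸ (j ℕ.+ k))) (suc n ∸ j)) (suc n)
      ≡⟨ Σ<-cong (suc n) row ⟩
    Σ< (λ j → f j * Σ< (λ k → g k * h (n ∸ j ∸ k)) (suc (n ∸ j))) (suc n) ∎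
    where
    open ≡-Reasoning
    row : ∀ j → j ℕ.< suc n → Σ< (λ k → f j * g (j ℕ.+ k ∸ j) * h (n ∸ (j ℕ.+ k))) (suc n ∸ j)
                               ≡ f j * Σ< (λ k → g k * h (n ∸ j ∸ k)) (suc (n ∸ j))
    row j (s≤s j≤n) rewrite ℕP.+-∸-assoc 1 j≤n = trans
      (Σ<-cong (suc (n ∸ j)) (λ k _ → trans
        (cong₂ (λ a b → f j * g a * h b) (ℕP.m+n∸m≡n j k) (sym (ℕP.∸-+-assoc n j k)))
        (ℤP.*-assoc (f j) (g k) (h (n ∸ j ∸ k)))))
      (*-distribˡ-Σ< (f j) _ (suc (n ∸ j)))

  ≐-isCommutativeRing : IsCommutativeRing _≐_ _⊕_ _⊛_ ⊖_ 𝟘 one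
  ≐-isCommutativeRing = record
    { isRing = record
      { +-isAbelianGroup = record
        { isGroup = record
          { isMonoid = record
            { isSemigroup = record
              { isMagma = record
                { isEquivalence = record
                  { refl = λ _ → refl ; sym = λ p n → sym (p n) ; trans = λ p q n → trans (p n) (q n) }
                ; ∙-cong = λ p q n → cong₂ _+_ (p n) (q n) }
              ; assoc = λ f g h n → ℤP.+-assoc (f n) (g n) (h n) }
            ; identity = (λ f n → ℤP.+-identityˡ (f n)) , (λ f n → ℤP.+-identityʳ (f n)) }
          ; inverse = (λ f n → ℤP.+-inverseˡ (f n)) , (λ f n → ℤP.+-inverseʳ (f n))
          ; ⁻¹-cong = λ p n → cong -_ (p n) }
        ; comm = λ f g n → ℤP.+-comm (f n) (g n) }
      ; *-cong = ⊛-cong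
      ; *-assoc = ⊛-assoc
      ; *-identity = ⊛-identityˡ , (λ f n → trans (⊛-comm f one n) (⊛-identityˡ f n))
      ; distrib = ⊛-distribˡ-⊕ , λ f g h n → trans (⊛-comm (g ⊕ h) f n)
                    (trans (⊛-distribˡ-⊕ f g h n) (cong₂ _+_ (⊛-comm f g n) (⊛-comm f h n))) }
    ; *-comm = ⊛-comm }

  seriesRing : CommutativeRing _ _
  seriesRing = record { isCommutativeRing = ≐-isCommutativeRing }

  open CommutativeRing seriesRing public using ()
    renaming (setoid to ≐-setoid; refl to ≐-refl; sym to ≐-sym; trans to ≐-trans; +-cong to ⊕-cong; -‿cong to ⊖-cong)

  ⊛-congˡ : ∀ f {g g′} → g ≐ g′ → f ⊛ g ≐ f ⊛ g′
  ⊛-congˡ f = ⊛-cong {f} {f} (λ _ → refl)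

  ⊛-congʳ : ∀ g {f f′} → f ≐ f′ → f ⊛ g ≐ f′ ⊛ g
  ⊛-congʳ g f≐f′ = ⊛-cong {g = g} f≐f′ (λ _ → refl)

  ⊕-congˡ : ∀ f {g g′} → g ≐ g′ → f ⊕ g ≐ f ⊕ g′
  ⊕-congˡ f g≐g′ n = cong (λ z → f n + z) (g≐g′ n)

  ⊕-congʳ : ∀ g {f f′} → f ≐ f′ → f ⊕ g ≐ f′ ⊕ g
  ⊕-congʳ g f≐f′ n = cong (_+ g n) (f≐f′ n)

  ⊛-identityʳ : ∀ f → f ⊛ one ≐ f
  ⊛-identityʳ f n = trans (⊛-comm f one n) (⊛-identityˡ f n)

  const-* : ∀ a b → const (a * b) ≐ const a ⊛ const b
  const-* a b zero = sym (const-⊛ a (const b) zero)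
  const-* a b (suc n) = sym (trans (const-⊛ a (const b) (suc n)) (ℤP.*-zeroʳ a))

  const-+ : ∀ a b → const (a + b) ≐ const a ⊕ const b
  const-+ a b zero = refl
  const-+ a b (suc n) = refl

  const-cong : ∀ {a b} → a ≡ b → const a ≐ const b
  const-cong refl = ≐-refl

  const-ℕ* : ∀ a b → const (+ (a ℕ.* b)) ≐ const (+ a) ⊛ const (+ b)
  const-ℕ* a b = ≐-trans (const-cong (ℤP.pos-* a b)) (const-* (+ a) (+ b))

  private
    ringACR : ACR.AlmostCommutativeRing _ _
    ringACR = ACR.fromCommutativeRing seriesRing

    constMorphism : ACR._-Raw-AlmostCommutative⟶_ ℤ.+-*-rawRing ringACR
    constMorphism = record
      { ⟦_⟧ = const
      ; +-homo = const-+
      ; *-homo = const-*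
      ; -‿homo = λ { a zero → refl ; a (suc n) → refl }
      ; 0-homo = λ { zero → refl ; (suc n) → refl }
      ; 1-homo = ≐-sym one≐𝟙 }

    const-≟ : ∀ a b → Maybe (const a ≐ const b)
    const-≟ a b with a ℤ.≟ b
    ... | yes refl = just ≐-refl
    ... | no _ = nothing

  module ⊛-Solver = RingSolver ℤ.+-*-rawRing ringACR constMorphism const-≟

  open ⊛-Solver using (solve; _:=_; _:+_; _:*_; _:-_; :-_; con)
  module ≐-Reasoning = Relation.Binary.Reasoning.Setoid ≐-setoid

  pow-cong : ∀ {f g} e → f ≐ g → pow f e ≐ pow g e
  pow-cong zero _ = ≐-refl
  pow-cong (suc e) f≐g = ⊛-cong (pow-cong e f≐g) f≐g

  pow-+ : ∀ f a b → pow f (a ℕ.+ b) ≐ pow f a ⊛ pow f b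
  pow-+ f a zero rewrite ℕP.+-identityʳ a = ≐-sym (⊛-identityʳ (pow f a))
  pow-+ f a (suc b) rewrite ℕP.+-suc a b = begin
    pow f (a ℕ.+ b) ⊛ f      ≈⟨ ⊛-congʳ f (pow-+ f a b) ⟩
    (pow f a ⊛ pow f b) ⊛ f  ≈⟨ ⊛-assoc (pow f a) (pow f b) f ⟩
    pow f a ⊛ (pow f b ⊛ f)  ∎
    where open ≐-Reasoning

  pow-* : ∀ f a b → pow f (a ℕ.* b) ≐ pow (pow f a) b
  pow-* f a zero rewrite ℕP.*-zeroʳ a = ≐-refl
  pow-* f a (suc b) rewrite ℕP.*-suc a b = begin
    pow f (a ℕ.+ a ℕ.* b)      ≈⟨ pow-+ f a (a ℕ.* b) ⟩
    pow f a ⊛ pow f (a ℕ.* b)  ≈⟨ ⊛-congˡ (pow f a) (pow-* f a b) ⟩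
    pow f a ⊛ pow (pow f a) b  ≈⟨ ⊛-comm (pow f a) (pow (pow f a) b) ⟩
    pow (pow f a) b ⊛ pow f a  ∎
    where open ≐-Reasoning

  pow-*-comm : ∀ f a b → pow f (a ℕ.* b) ≐ pow (pow f b) a
  pow-*-comm f a b = ≐-trans (λ n → cong (λ e → pow f e n) (ℕP.*-comm a b)) (pow-* f b a)

  pow-distrib-⊛ : ∀ f g e → pow (f ⊛ g) e ≐ pow f e ⊛ pow g e
  pow-distrib-⊛ f g zero = ≐-sym (⊛-identityˡ one)
  pow-distrib-⊛ f g (suc e) = begin
    pow (f ⊛ g) e ⊛ (f ⊛ g)        ≈⟨ ⊛-congʳ (f ⊛ g) (pow-distrib-⊛ f g e) ⟩
    (pow f e ⊛ pow g e) ⊛ (f ⊛ g)  ≈⟨ solve 4 (λ a b c d → (a :* b) :* (c :* d) := (a :* c) :* (b :* d)) (λ _ → refl)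
                                             (pow f e) (pow g e) f g ⟩
    (pow f e ⊛ f) ⊛ (pow g e ⊛ g)  ∎
    where open ≐-Reasoning

  pow-one : ∀ e → pow one e ≐ one
  pow-one zero = ≐-refl
  pow-one (suc e) = ≐-trans (⊛-congʳ one (pow-one e)) (⊛-identityˡ one)

  pow-inverse : ∀ {f g} e → f ⊛ g ≐ one → pow f e ⊛ pow g e ≐ one
  pow-inverse {f} {g} e fg≐1 = ≐-trans (≐-sym (pow-distrib-⊛ f g e)) (≐-trans (pow-cong e fg≐1) (pow-one e))

  infix 4 _∣ₛ_
  _∣ₛ_ : ℕ → Series → Set
  q ∣ₛ f = ∀ n → + q ∣ℤ f n

  ∣ₛ-resp-≐ : ∀ {q f g} → f ≐ g → q ∣ₛ f → q ∣ₛ g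
  ∣ₛ-resp-≐ f≐g q∣f n = subst (_ ∣ℤ_) (f≐g n) (q∣f n)

  ∣ₛ-⊕ : ∀ {q f g} → q ∣ₛ f → q ∣ₛ g → q ∣ₛ f ⊕ g
  ∣ₛ-⊕ q∣f q∣g n = ℤD.∣m∣n⇒∣m+n (q∣f n) (q∣g n)

  ∣ₛ-⊖ : ∀ {q f} → q ∣ₛ f → q ∣ₛ ⊖ f
  ∣ₛ-⊖ q∣f n = ℤD.∣m⇒∣-m (q∣f n)

  ∣ℤ-Σ< : ∀ {k} (f : ℕ → ℤ) n → (∀ i → k ∣ℤ f i) → k ∣ℤ Σ< f n
  ∣ℤ-Σ< f zero _ = divides 0ℤ refl
  ∣ℤ-Σ< f (suc n) k∣f = ℤD.∣m∣n⇒∣m+n (∣ℤ-Σ< f n k∣f) (k∣f n)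

  ∣ₛ-⊛ʳ : ∀ {q f} g → q ∣ₛ f → q ∣ₛ f ⊛ g
  ∣ₛ-⊛ʳ g q∣f n = ∣ℤ-Σ< _ (suc n) (λ i → ℤD.∣m⇒∣m*n (g (n ∸ i)) (q∣f i))

  ∣ₛ-⊛ˡ : ∀ {q} f {g} → q ∣ₛ g → q ∣ₛ f ⊛ g
  ∣ₛ-⊛ˡ f {g} q∣g = ∣ₛ-resp-≐ (⊛-comm g f) (∣ₛ-⊛ʳ f q∣g)

  ∣ₛ-const⊛ : ∀ q f → q ∣ₛ const (+ q) ⊛ f
  ∣ₛ-const⊛ q f = ∣ₛ-resp-≐ (≐-sym (const-⊛ (+ q) f)) (λ n → ℤD.∣m⇒∣m*n (f n) ℤD.∣-refl)

  ∣ₛ-const : ∀ q → q ∣ₛ const (+ q)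
  ∣ₛ-const q = ∣ₛ-resp-≐ (⊛-identityʳ (const (+ q))) (∣ₛ-const⊛ q one)

  ∣ₛ-weaken : ∀ {q r f} → q ℕD.∣ r → r ∣ₛ f → q ∣ₛ f
  ∣ₛ-weaken {q} {r} q∣r r∣f n = ℤD.∣-trans (ℤD.∣ᵤ⇒∣ {+ q} {+ r} q∣r) (r∣f n)

  ∣ₛ-quotient : ∀ {q f} → q ∣ₛ f → Σ[ h ∈ Series ] f ≐ const (+ q) ⊛ h
  ∣ₛ-quotient {q} {f} q∣f = h , λ n → trans (ℤD._∣_.equality (q∣f n))
    (trans (ℤP.*-comm (h n) (+ q)) (sym (const-⊛ (+ q) h n)))
    where
    h : Series
    h n = ℤD._∣_.quotient (q∣f n)

  ∣ₛ-⊛ : ∀ {q r f g} → q ∣ₛ f → r ∣ₛ g → q ℕ.* r ∣ₛ f ⊛ g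
  ∣ₛ-⊛ {q} {r} {f} {g} q∣f r∣g with ∣ₛ-quotient q∣f | ∣ₛ-quotient r∣g
  ... | f′ , f≐ | g′ , g≐ = ∣ₛ-resp-≐ (≐-sym (begin
    f ⊛ g                                    ≈⟨ ⊛-cong f≐ g≐ ⟩
    (const (+ q) ⊛ f′) ⊛ (const (+ r) ⊛ g′)  ≈⟨ solve 4 (λ a x b y → (a :* x) :* (b :* y) := (a :* b) :* (x :* y)) (λ _ → refl)
                                                       (const (+ q)) f′ (const (+ r)) g′ ⟩
    (const (+ q) ⊛ const (+ r)) ⊛ (f′ ⊛ g′)  ≈⟨ ⊛-congʳ (f′ ⊛ g′) (const-ℕ* q r) ⟨
    const (+ (q ℕ.* r)) ⊛ (f′ ⊛ g′)          ∎)) (∣ₛ-const⊛ (q ℕ.* r) (f′ ⊛ g′))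
    where open ≐-Reasoning

  geom-∣ : ∀ K n → K ℕD.∣ n → geom K n ≡ 1ℤ
  geom-∣ K n K∣n = cong (if_then 1ℤ else 0ℤ) (dec-true (K ℕD.∣? n) K∣n)

  geom-∤ : ∀ K n → ¬ K ℕD.∣ n → geom K n ≡ 0ℤ
  geom-∤ K n K∤n = cong (if_then 1ℤ else 0ℤ) (dec-false (K ℕD.∣? n) K∤n)

  geom-periodic : ∀ K n → K ℕ.≤ n → geom K n ≡ geom K (n ∸ K)
  geom-periodic K n K≤n = by-cases (K ℕD.∣? (n ∸ K))
    where
    by-cases : Dec (K ℕD.∣ n ∸ K) → geom K n ≡ geom K (n ∸ K)
    by-cases (yes K∣n-K) = trans (geom-∣ K n (ℕD.∣m∸n∣n⇒∣m K K≤n K∣n-K ℕD.∣-refl)) (sym (geom-∣ K (n ∸ K) K∣n-K))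
    by-cases (no K∤n-K) = trans (geom-∤ K n K∤n) (sym (geom-∤ K (n ∸ K) K∤n-K))
      where
      K∤n : ¬ K ℕD.∣ n
      K∤n K∣n = K∤n-K (ℕD.∣m+n∣m⇒∣n (subst (K ℕD.∣_) (sym (ℕP.m+[n∸m]≡n K≤n)) K∣n) ℕD.∣-refl)

  oneMinus-diag : ∀ k → oneMinus (suc k) (suc k) ≡ - 1ℤ
  oneMinus-diag k = cong (if_then - 1ℤ else 0ℤ) (dec-true (suc k ℕ.≟ suc k) refl)

  oneMinus-off : ∀ K n → K ≢ suc n → oneMinus K (suc n) ≡ 0ℤ
  oneMinus-off K n K≢1+n = cong (if_then - 1ℤ else 0ℤ) (dec-false (K ℕ.≟ suc n) K≢1+n)

  private
    oneMinus-term : ℕ → Series → ℕ → ℕ → ℤ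
    oneMinus-term k f n i = oneMinus (suc k) (suc i) * f (n ∸ suc i)

    oneMinus-term-off : ∀ k f n i → i ≢ k → oneMinus-term k f n i ≡ 0ℤ
    oneMinus-term-off k f n i i≢k =
      trans (cong (_* f (n ∸ suc i)) (oneMinus-off (suc k) i (i≢k ∘ sym ∘ ℕP.suc-injective))) (ℤP.*-zeroˡ (f (n ∸ suc i)))

    oneMinus-⊛ : ∀ k f n → (oneMinus (suc k) ⊛ f) n ≡ f n + Σ< (oneMinus-term k f n) n
    oneMinus-⊛ k f n = trans (Σ<-head _ n) (cong (_+ Σ< (oneMinus-term k f n) n) (ℤP.*-identityˡ (f n)))

  oneMinus-⊛-below : ∀ K .{{_ : ℕ.NonZero K}} f n → n ℕ.< K → (oneMinus K ⊛ f) n ≡ f n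
  oneMinus-⊛-below (suc k) f n (s≤s n≤k) = begin
    (oneMinus (suc k) ⊛ f) n ≡⟨ oneMinus-⊛ k f n ⟩
    f n + Σ< (oneMinus-term k f n) n
      ≡⟨ cong (λ z → f n + z) (Σ<-zero n (λ i i<n → oneMinus-term-off k f n i (ℕP.<⇒≢ (ℕP.<-≤-trans i<n n≤k)))) ⟩
    f n + 0ℤ                 ≡⟨ ℤP.+-identityʳ (f n) ⟩
    f n                      ∎
    where open ≡-Reasoning

  oneMinus-⊛-above : ∀ K .{{_ : ℕ.NonZero K}} f n → K ℕ.≤ n → (oneMinus K ⊛ f) n ≡ f n - f (n ∸ K)
  oneMinus-⊛-above (suc k) f n K≤n = begin
    (oneMinus (suc k) ⊛ f) n                        ≡⟨ oneMinus-⊛ k f n ⟩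
    f n + Σ< (oneMinus-term k f n) n
      ≡⟨ cong (λ z → f n + z) (Σ<-single k n (oneMinus-term-off k f n) K≤n) ⟩
    f n + oneMinus (suc k) (suc k) * f (n ∸ suc k)  ≡⟨ cong (λ c → f n + c * f (n ∸ suc k)) (oneMinus-diag k) ⟩
    f n + - 1ℤ * f (n ∸ suc k)                      ≡⟨ cong (λ z → f n + z) (ℤP.-1*i≡-i (f (n ∸ suc k))) ⟩
    f n - f (n ∸ suc k)                             ∎
    where open ≡-Reasoning

  infix 4 _≡1-mod-x^_
  _≡1-mod-x^_ : Series → ℕ → Set
  f ≡1-mod-x^ M = ∀ n → n ℕ.< M → f n ≡ one n

  ≡1-mod-x^-⊛-coeff : ∀ {M f} → f ≡1-mod-x^ M → ∀ g n → n ℕ.< M → (f ⊛ g) n ≡ g n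
  ≡1-mod-x^-⊛-coeff f≡1 g n n<M =
    trans (Σ<-cong (suc n) (λ i i≤n → cong (_* g (n ∸ i)) (f≡1 i (ℕP.<-≤-trans i≤n n<M)))) (⊛-identityˡ g n)

  ≡1-mod-x^-⊛ : ∀ {M f g} → f ≡1-mod-x^ M → g ≡1-mod-x^ M → f ⊛ g ≡1-mod-x^ M
  ≡1-mod-x^-⊛ {g = g} f≡1 g≡1 n n<M = trans (≡1-mod-x^-⊛-coeff f≡1 g n n<M) (g≡1 n n<M)

  ≡1-mod-x^-pow : ∀ {M f} e → f ≡1-mod-x^ M → pow f e ≡1-mod-x^ M
  ≡1-mod-x^-pow zero _ _ _ = refl
  ≡1-mod-x^-pow (suc e) f≡1 = ≡1-mod-x^-⊛ (≡1-mod-x^-pow e f≡1) f≡1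

  geom-≡1-mod-x^ : ∀ K .{{_ : ℕ.NonZero K}} → geom K ≡1-mod-x^ K
  geom-≡1-mod-x^ K zero _ = geom-∣ K 0 (ℕD._∣0 K)
  geom-≡1-mod-x^ K (suc n) n<K = geom-∤ K (suc n) (λ K∣n → ℕP.<⇒≱ n<K (ℕD.∣⇒≤ K∣n))

  oneMinus-≡1-mod-x^ : ∀ K → oneMinus K ≡1-mod-x^ K
  oneMinus-≡1-mod-x^ K zero _ = refl
  oneMinus-≡1-mod-x^ K (suc n) n<K = oneMinus-off K n (λ K≡1+n → ℕP.<-irrefl (sym K≡1+n) n<K)

  oneMinus-⊛-geom : ∀ K .{{_ : ℕ.NonZero K}} → oneMinus K ⊛ geom K ≐ one
  oneMinus-⊛-geom K n with n ℕ.<? K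
  ... | yes n<K = trans (oneMinus-⊛-below K (geom K) n n<K) (geom-≡1-mod-x^ K n n<K)
  ... | no n≮K = begin
    (oneMinus K ⊛ geom K) n        ≡⟨ oneMinus-⊛-above K (geom K) n K≤n ⟩
    geom K n - geom K (n ∸ K)      ≡⟨ cong (_- geom K (n ∸ K)) (geom-periodic K n K≤n) ⟩
    geom K (n ∸ K) - geom K (n ∸ K) ≡⟨ ℤP.+-inverseʳ (geom K (n ∸ K)) ⟩
    0ℤ                             ≡⟨ one-above n (ℕP.<-≤-trans (ℕ.>-nonZero⁻¹ K) K≤n) ⟨
    one n                          ∎
    where
    open ≡-Reasoning
    K≤n = ℕP.≮⇒≥ n≮K
    one-above : ∀ n → 0 ℕ.< n → one n ≡ 0ℤ
    one-above (suc n) _ = refl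

  geom-⊛-oneMinus : ∀ K .{{_ : ℕ.NonZero K}} → geom K ⊛ oneMinus K ≐ one
  geom-⊛-oneMinus K = ≐-trans (⊛-comm (geom K) (oneMinus K)) (oneMinus-⊛-geom K)

  -- altBinom e j = (-1)^j C(e,j), the coefficient of x^j in (1 - x)^e.
  altBinom : ℕ → ℕ → ℤ
  altBinom e zero = 1ℤ
  altBinom zero (suc j) = 0ℤ
  altBinom (suc e) (suc j) = altBinom e (suc j) - altBinom e j

  altBinom-absorb : ∀ e j → + suc j * altBinom (suc e) (suc j) ≡ - (+ suc e) * altBinom e j
  altBinom-absorb zero zero = refl
  altBinom-absorb zero (suc j) = ℤP.*-zeroʳ (+ suc (suc j))
  altBinom-absorb (suc e) zero = begin
    + 1 * (altBinom (suc e) 1 - 1ℤ)      ≡⟨ cong (λ a → + 1 * (a - 1ℤ)) (trans (sym (ℤP.*-identityˡ _)) (altBinom-absorb e zero)) ⟩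
    + 1 * (- (+ suc e) * 1ℤ - 1ℤ)        ≡⟨ rearrange (+ suc e) ⟩
    - (+ 1 + + suc e) * 1ℤ               ∎
    where
    open ≡-Reasoning
    rearrange : ∀ x → + 1 * (- x * 1ℤ - 1ℤ) ≡ - (+ 1 + x) * 1ℤ
    rearrange = solve-∀
  altBinom-absorb (suc e) (suc j) = begin
    (+ 1 + j₊) * (A - B)                        ≡⟨ expand A B j₊ ⟩
    (+ 1 + j₊) * A - (j₊ * B + B)               ≡⟨ cong₂ (λ a b → a - (b + B)) (altBinom-absorb e (suc j)) (altBinom-absorb e j) ⟩
    - e₊ * a - (- e₊ * b + (a - b))             ≡⟨ collect a b e₊ ⟩
    - (+ 1 + e₊) * (a - b)                      ∎
    where
    open ≡-Reasoning
    j₊ = + suc j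
    e₊ = + suc e
    A = altBinom (suc e) (suc (suc j))
    B = altBinom (suc e) (suc j)
    a = altBinom e (suc j)
    b = altBinom e j
    expand : ∀ A B J → (+ 1 + J) * (A - B) ≡ (+ 1 + J) * A - (J * B + B)
    expand = solve-∀
    collect : ∀ a b E → - E * a - (- E * b + (a - b)) ≡ - (+ 1 + E) * (a - b)
    collect = solve-∀

  altBinom-vanish : ∀ e j → e ℕ.< j → altBinom e j ≡ 0ℤ
  altBinom-vanish zero (suc j) _ = refl
  altBinom-vanish (suc e) (suc j) (s≤s e<j)
    rewrite altBinom-vanish e (suc j) (ℕP.m<n⇒m<1+n e<j) | altBinom-vanish e j e<j = refl

  altBinom-odd-diag : ∀ t → altBinom (suc (t ℕ.+ t)) (suc (t ℕ.+ t)) ≡ - 1ℤ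
  altBinom-odd-diag zero = refl
  altBinom-odd-diag (suc t) rewrite ℕP.+-suc t t = trans two-steps (altBinom-odd-diag t)
    where
    e = suc (t ℕ.+ t)
    two-steps : altBinom (suc (suc e)) (suc (suc e)) ≡ altBinom e e
    two-steps rewrite altBinom-vanish (suc e) (suc (suc e)) ℕP.≤-refl | altBinom-vanish e (suc e) ℕP.≤-refl =
      cancel (altBinom e e)
      where
      cancel : ∀ x → 0ℤ - (0ℤ - x) ≡ x
      cancel = solve-∀

  pow-oneMinus-∤ : ∀ K .{{_ : ℕ.NonZero K}} e n → ¬ K ℕD.∣ n → pow (oneMinus K) e n ≡ 0ℤ
  pow-oneMinus-∤ K zero zero K∤0 = ⊥-elim (K∤0 (ℕD._∣0 K))
  pow-oneMinus-∤ K zero (suc n) _ = refl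
  pow-oneMinus-∤ K (suc e) n K∤n with n ℕ.<? K
  ... | yes n<K = trans (⊛-comm (pow (oneMinus K) e) (oneMinus K) n)
                    (trans (oneMinus-⊛-below K (pow (oneMinus K) e) n n<K) (pow-oneMinus-∤ K e n K∤n))
  ... | no n≮K = trans (⊛-comm (pow (oneMinus K) e) (oneMinus K) n)
                   (trans (oneMinus-⊛-above K (pow (oneMinus K) e) n K≤n)
                   (cong₂ _-_ (pow-oneMinus-∤ K e n K∤n) (pow-oneMinus-∤ K e (n ∸ K) K∤n-K)))
    where
    K≤n = ℕP.≮⇒≥ n≮K
    K∤n-K : ¬ K ℕD.∣ n ∸ K
    K∤n-K K∣n-K = K∤n (ℕD.∣m∸n∣n⇒∣m K K≤n K∣n-K ℕD.∣-refl)

  pow-oneMinus-mult : ∀ K .{{_ : ℕ.NonZero K}} e j → pow (oneMinus K) e (j ℕ.* K) ≡ altBinom e j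
  pow-oneMinus-mult K zero zero = refl
  pow-oneMinus-mult (suc k) zero (suc j) = refl
  pow-oneMinus-mult K (suc e) zero = trans (⊛-comm (pow (oneMinus K) e) (oneMinus K) 0)
    (trans (oneMinus-⊛-below K (pow (oneMinus K) e) 0 (ℕ.>-nonZero⁻¹ K)) (pow-oneMinus-mult K e zero))
  pow-oneMinus-mult K (suc e) (suc j) = trans (⊛-comm (pow (oneMinus K) e) (oneMinus K) (suc j ℕ.* K))
    (trans (oneMinus-⊛-above K (pow (oneMinus K) e) (suc j ℕ.* K) (ℕP.m≤m+n K (j ℕ.* K)))
    (cong₂ _-_ (pow-oneMinus-mult K e (suc j))
               (trans (cong (pow (oneMinus K) e) (ℕP.m+n∸m≡n K (j ℕ.* K))) (pow-oneMinus-mult K e j))))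

  -- Substituting x^K for x

  infixl 8 _∘x^_
  _∘x^_ : (ℕ → ℤ) → ℕ → Series
  (f ∘x^ K) n with K ℕD.∣? n
  ... | yes (ℕD.divides j _) = f j
  ... | no _ = 0ℤ

  ∘x^-mult : ∀ f K .{{_ : ℕ.NonZero K}} j → (f ∘x^ K) (j ℕ.* K) ≡ f j
  ∘x^-mult f K j with K ℕD.∣? (j ℕ.* K)
  ... | yes (ℕD.divides i jK≡iK) = cong f (ℕP.*-cancelʳ-≡ i j K (sym jK≡iK))
  ... | no K∤jK = ⊥-elim (K∤jK (ℕD.n∣m*n j))

  ∘x^-∤ : ∀ f K n → ¬ K ℕD.∣ n → (f ∘x^ K) n ≡ 0ℤ
  ∘x^-∤ f K n K∤n with K ℕD.∣? n
  ... | yes K∣n = ⊥-elim (K∤n K∣n)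
  ... | no _ = refl

  ≐-∘x^ : ∀ {g} f K → (∀ j → g (j ℕ.* K) ≡ f j) → (∀ n → ¬ K ℕD.∣ n → g n ≡ 0ℤ) → g ≐ f ∘x^ K
  ≐-∘x^ f K on-mult off-mult n with K ℕD.∣? n
  ... | yes (ℕD.divides j refl) = on-mult j
  ... | no K∤n = off-mult n K∤n

  pow-oneMinus≐ : ∀ K .{{_ : ℕ.NonZero K}} e → pow (oneMinus K) e ≐ altBinom e ∘x^ K
  pow-oneMinus≐ K e = ≐-∘x^ (altBinom e) K (pow-oneMinus-mult K e) (pow-oneMinus-∤ K e)

  oneMinus-*-mult : ∀ m K .{{_ : ℕ.NonZero K}} j → oneMinus (m ℕ.* K) (j ℕ.* K) ≡ oneMinus m j
  oneMinus-*-mult m K zero = refl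
  oneMinus-*-mult m (suc k) (suc j) = by-cases (m ℕ.≟ suc j)
    where
    by-cases : Dec (m ≡ suc j) → oneMinus (m ℕ.* suc k) (suc j ℕ.* suc k) ≡ oneMinus m (suc j)
    by-cases (yes refl) = trans (oneMinus-diag (k ℕ.+ j ℕ.* suc k)) (sym (oneMinus-diag j))
    by-cases (no m≢1+j) = trans (oneMinus-off (m ℕ.* suc k) (k ℕ.+ j ℕ.* suc k) (m≢1+j ∘ ℕP.*-cancelʳ-≡ m (suc j) (suc k)))
                                (sym (oneMinus-off m j m≢1+j))

  oneMinus-*-∤ : ∀ m K n → ¬ K ℕD.∣ n → oneMinus (m ℕ.* K) n ≡ 0ℤ
  oneMinus-*-∤ m K zero K∤0 = ⊥-elim (K∤0 (ℕD._∣0 K))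
  oneMinus-*-∤ m K (suc n) K∤n = oneMinus-off (m ℕ.* K) n (λ mK≡1+n → K∤n (ℕD.divides m (sym mK≡1+n)))

  oneMinus-*-⊛-∘x^ : ∀ m K .{{_ : ℕ.NonZero m}} .{{_ : ℕ.NonZero K}} f →
    oneMinus (m ℕ.* K) ⊛ (f ∘x^ K) ≐ (oneMinus m ⊛ f) ∘x^ K
  oneMinus-*-⊛-∘x^ m K f = ≐-∘x^ (oneMinus m ⊛ f) K on-mult off-mult
    where
    instance
      mK-nonZero : ℕ.NonZero (m ℕ.* K)
      mK-nonZero = ℕP.m*n≢0 m K
    on-mult : ∀ j → (oneMinus (m ℕ.* K) ⊛ (f ∘x^ K)) (j ℕ.* K) ≡ (oneMinus m ⊛ f) j
    on-mult j with j ℕ.<? m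
    ... | yes j<m = begin
      (oneMinus (m ℕ.* K) ⊛ (f ∘x^ K)) (j ℕ.* K)  ≡⟨ oneMinus-⊛-below (m ℕ.* K) (f ∘x^ K) (j ℕ.* K) (ℕP.*-monoˡ-< K j<m) ⟩
      (f ∘x^ K) (j ℕ.* K)                         ≡⟨ ∘x^-mult f K j ⟩
      f j                                         ≡⟨ oneMinus-⊛-below m f j j<m ⟨
      (oneMinus m ⊛ f) j                          ∎
      where open ≡-Reasoning
    ... | no j≮m = begin
      (oneMinus (m ℕ.* K) ⊛ (f ∘x^ K)) (j ℕ.* K)
        ≡⟨ oneMinus-⊛-above (m ℕ.* K) (f ∘x^ K) (j ℕ.* K) (ℕP.*-monoˡ-≤ K m≤j) ⟩
      (f ∘x^ K) (j ℕ.* K) - (f ∘x^ K) (j ℕ.* K ∸ m ℕ.* K)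
        ≡⟨ cong (λ i → (f ∘x^ K) (j ℕ.* K) - (f ∘x^ K) i) (ℕP.*-distribʳ-∸ K j m) ⟨
      (f ∘x^ K) (j ℕ.* K) - (f ∘x^ K) ((j ∸ m) ℕ.* K)         ≡⟨ cong₂ _-_ (∘x^-mult f K j) (∘x^-mult f K (j ∸ m)) ⟩
      f j - f (j ∸ m)                                         ≡⟨ oneMinus-⊛-above m f j m≤j ⟨
      (oneMinus m ⊛ f) j                                      ∎
      where
      open ≡-Reasoning
      m≤j = ℕP.≮⇒≥ j≮m
    off-mult : ∀ n → ¬ K ℕD.∣ n → (oneMinus (m ℕ.* K) ⊛ (f ∘x^ K)) n ≡ 0ℤ
    off-mult n K∤n with n ℕ.<? m ℕ.* K
    ... | yes n<mK = trans (oneMinus-⊛-below (m ℕ.* K) (f ∘x^ K) n n<mK) (∘x^-∤ f K n K∤n)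
    ... | no n≮mK = trans (oneMinus-⊛-above (m ℕ.* K) (f ∘x^ K) n mK≤n)
                      (cong₂ _-_ (∘x^-∤ f K n K∤n) (∘x^-∤ f K (n ∸ m ℕ.* K) K∤n-mK))
      where
      mK≤n = ℕP.≮⇒≥ n≮mK
      K∤n-mK : ¬ K ℕD.∣ n ∸ m ℕ.* K
      K∤n-mK K∣n-mK = K∤n (ℕD.∣m∸n∣n⇒∣m K mK≤n K∣n-mK (ℕD.n∣m*n m))

  -- Powers of 1 + p E for odd p

  choose2 : ℕ → ℕ
  choose2 zero = 0
  choose2 (suc c) = choose2 c ℕ.+ c

  choose2-odd : ∀ t → choose2 (suc (t ℕ.+ t)) ≡ suc (t ℕ.+ t) ℕ.* t
  choose2-odd zero = refl
  choose2-odd (suc t) rewrite ℕP.+-suc t t | choose2-odd t = arith t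
    where
    arith : ∀ t → suc (t ℕ.+ t) ℕ.* t ℕ.+ suc (t ℕ.+ t) ℕ.+ suc (suc (t ℕ.+ t)) ≡ suc (suc (suc (t ℕ.+ t))) ℕ.* suc t
    arith = ℕ-solve-∀

  secondOrder : ℕ → Series → Series → Series
  secondOrder c y R = ((𝟙 ⊕ const (+ c) ⊛ y) ⊕ const (+ choose2 c) ⊛ (y ⊛ y)) ⊕ (y ⊛ (y ⊛ y)) ⊛ R

  binomial-secondOrder : ∀ y c → Σ[ R ∈ Series ] pow (𝟙 ⊕ y) c ≐ secondOrder c y R
  binomial-secondOrder y zero = const 0ℤ , ≐-trans one≐𝟙
    (solve 1 (λ y → con 1ℤ := ((con 1ℤ :+ con 0ℤ :* y) :+ con 0ℤ :* (y :* y)) :+ (y :* (y :* y)) :* con 0ℤ) (λ _ → refl) y)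
  binomial-secondOrder y (suc c) with binomial-secondOrder y c
  ... | R , pow≐ = R′ , (begin
    pow (𝟙 ⊕ y) c ⊛ (𝟙 ⊕ y)        ≈⟨ ⊛-congʳ (𝟙 ⊕ y) pow≐ ⟩
    secondOrder c y R ⊛ (𝟙 ⊕ y)    ≈⟨ multiply (const (+ c)) (const (+ choose2 c)) y R ⟩
    ((𝟙 ⊕ (𝟙 ⊕ const (+ c)) ⊛ y) ⊕ (const (+ choose2 c) ⊕ const (+ c)) ⊛ (y ⊛ y)) ⊕ (y ⊛ (y ⊛ y)) ⊛ R′
      ≈⟨ ⊕-congʳ ((y ⊛ (y ⊛ y)) ⊛ R′) (⊕-cong (⊕-congˡ 𝟙 (⊛-congʳ y (≐-sym (const-+ 1ℤ (+ c)))))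
                                              (⊛-congʳ (y ⊛ y) (≐-sym (const-+ (+ choose2 c) (+ c))))) ⟩
    secondOrder (suc c) y R′        ∎)
    where
    open ≐-Reasoning
    R′ = (const (+ choose2 c) ⊕ R) ⊕ R ⊛ y
    multiply : ∀ C T y R → (((𝟙 ⊕ C ⊛ y) ⊕ T ⊛ (y ⊛ y)) ⊕ (y ⊛ (y ⊛ y)) ⊛ R) ⊛ (𝟙 ⊕ y)
                         ≐ ((𝟙 ⊕ (𝟙 ⊕ C) ⊛ y) ⊕ (T ⊕ C) ⊛ (y ⊛ y)) ⊕ (y ⊛ (y ⊛ y)) ⊛ ((T ⊕ R) ⊕ R ⊛ y)
    multiply = solve 4 (λ C T y R → (((con 1ℤ :+ C :* y) :+ T :* (y :* y)) :+ (y :* (y :* y)) :* R) :* (con 1ℤ :+ y)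
                          := ((con 1ℤ :+ (con 1ℤ :+ C) :* y) :+ (T :+ C) :* (y :* y)) :+ (y :* (y :* y)) :* ((T :+ R) :+ R :* y))
                       (λ _ → refl)

  inverse-1+PW : ∀ P W f → f ⊛ (𝟙 ⊕ P ⊛ W) ≐ 𝟙 → f ≐ 𝟙 ⊕ P ⊛ (⊖ W ⊕ P ⊛ (f ⊛ (W ⊛ W)))
  inverse-1+PW P W f f-inverse = begin
    f                                                       ≈⟨ expand f P W ⟩
    E ⊕ (f ⊛ (𝟙 ⊕ P ⊛ W) ⊕ ⊖ 𝟙) ⊛ (𝟙 ⊕ ⊖ (P ⊛ W))
      ≈⟨ ⊕-congˡ E (⊛-congʳ (𝟙 ⊕ ⊖ (P ⊛ W)) (⊕-congʳ (⊖ 𝟙) f-inverse)) ⟩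
    E ⊕ (𝟙 ⊕ ⊖ 𝟙) ⊛ (𝟙 ⊕ ⊖ (P ⊛ W))                          ≈⟨ vanish E (𝟙 ⊕ ⊖ (P ⊛ W)) ⟩
    E                                                       ∎
    where
    open ≐-Reasoning
    E = 𝟙 ⊕ P ⊛ (⊖ W ⊕ P ⊛ (f ⊛ (W ⊛ W)))
    expand : ∀ f P W → f ≐ (𝟙 ⊕ P ⊛ (⊖ W ⊕ P ⊛ (f ⊛ (W ⊛ W))))
                              ⊕ (f ⊛ (𝟙 ⊕ P ⊛ W) ⊕ ⊖ 𝟙) ⊛ (𝟙 ⊕ ⊖ (P ⊛ W))
    expand = solve 3 (λ f P W → f := (con 1ℤ :+ P :* (:- W :+ P :* (f :* (W :* W))))
                                      :+ (f :* (con 1ℤ :+ P :* W) :+ (:- con 1ℤ)) :* (con 1ℤ :+ (:- (P :* W)))) (λ _ → refl)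
    vanish : ∀ E X → E ⊕ (𝟙 ⊕ ⊖ 𝟙) ⊛ X ≐ E
    vanish = solve 2 (λ E X → E :+ (con 1ℤ :+ (:- con 1ℤ)) :* X := E) (λ _ → refl)

  infix 4 _≐_[mod_]
  _≐_[mod_] : Series → Series → ℕ → Set
  f ≐ g [mod q ] = q ∣ₛ f ⊕ ⊖ g

  module OddPowers (p t : ℕ) (p≡2t+1 : p ≡ suc (t ℕ.+ t)) where

    P : Series
    P = const (+ p)

    p^ : ℕ → Series
    p^ k = const (+ (p ^ k))

    p^-suc : ∀ k → p^ (suc k) ≐ P ⊛ p^ k
    p^-suc k = const-ℕ* p (p ^ k)

    p^-∣-p^ : ∀ {a b} → a ℕ.≤ b → p ^ a ℕD.∣ p ^ b
    p^-∣-p^ {a} {b} a≤b = ℕD.divides (p ^ (b ∸ a))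
      (trans (cong (p ^_) (sym (ℕP.m∸n+n≡m a≤b))) (ℕP.^-distribˡ-+-* p (b ∸ a) a))

    ∣ₛ-p^-weaken : ∀ {a b f} → a ℕ.≤ b → p ^ b ∣ₛ f → p ^ a ∣ₛ f
    ∣ₛ-p^-weaken a≤b = ∣ₛ-weaken (p^-∣-p^ a≤b)

    ∣ₛ-p^-⊛ : ∀ a b {f g} → p ^ a ∣ₛ f → p ^ b ∣ₛ g → p ^ (a ℕ.+ b) ∣ₛ f ⊛ g
    ∣ₛ-p^-⊛ a b p^a∣f p^b∣g = subst (_∣ₛ _) (sym (ℕP.^-distribˡ-+-* p a b)) (∣ₛ-⊛ p^a∣f p^b∣g)

    choose2-p : const (+ choose2 p) ≐ P ⊛ const (+ t)
    choose2-p = ≐-trans (const-cong (cong +_ (trans (cong choose2 p≡2t+1)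
                          (trans (choose2-odd t) (cong (ℕ._* t) (sym p≡2t+1)))))) (const-ℕ* p t)

    -- The middle term C(p,2) Y² of (1 + Y)^p is divisible by p Y² only because p is odd.
    pow-p-1+p^F : ∀ a F → Σ[ Z ∈ Series ] pow (𝟙 ⊕ p^ (suc a) ⊛ F) p ≐ 𝟙 ⊕ p^ (2 ℕ.+ a) ⊛ (F ⊕ P ⊛ Z)
    pow-p-1+p^F a F = Z , (begin
      pow (𝟙 ⊕ Y) p                                          ≈⟨ proj₂ (binomial-secondOrder Y p) ⟩
      secondOrder p Y R
        ≈⟨ ⊕-congʳ ((Y ⊛ (Y ⊛ Y)) ⊛ R) (⊕-congˡ (𝟙 ⊕ P ⊛ Y) (⊛-congʳ (Y ⊛ Y) choose2-p)) ⟩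
      ((𝟙 ⊕ P ⊛ Y) ⊕ (P ⊛ T) ⊛ (Y ⊛ Y)) ⊕ (Y ⊛ (Y ⊛ Y)) ⊛ R  ≈⟨ factor-Y² P T Y R ⟩
      (𝟙 ⊕ P ⊛ Y) ⊕ (Y ⊛ Y) ⊛ (P ⊛ T ⊕ Y ⊛ R)
        ≈⟨ ⊕-cong (⊕-congˡ 𝟙 PY≐) (proj₂ (∣ₛ-quotient p³⁺ᵃ∣rest)) ⟩
      (𝟙 ⊕ p^ (2 ℕ.+ a) ⊛ F) ⊕ p^ (3 ℕ.+ a) ⊛ Z
        ≈⟨ ⊕-congˡ (𝟙 ⊕ p^ (2 ℕ.+ a) ⊛ F) (⊛-congʳ Z p³⁺ᵃ≐) ⟩
      (𝟙 ⊕ p^ (2 ℕ.+ a) ⊛ F) ⊕ (p^ (2 ℕ.+ a) ⊛ P) ⊛ Z        ≈⟨ factor-p²⁺ᵃ (p^ (2 ℕ.+ a)) F P Z ⟩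
      𝟙 ⊕ p^ (2 ℕ.+ a) ⊛ (F ⊕ P ⊛ Z)                         ∎)
      where
      open ≐-Reasoning
      T = const (+ t)
      Y = p^ (suc a) ⊛ F
      R = proj₁ (binomial-secondOrder Y p)
      p³⁺ᵃ∣rest : p ^ (3 ℕ.+ a) ∣ₛ (Y ⊛ Y) ⊛ (P ⊛ T ⊕ Y ⊛ R)
      p³⁺ᵃ∣rest = ∣ₛ-p^-weaken (ℕP.≤-trans (s≤s (s≤s (s≤s (ℕP.m≤n+m a a)))) (ℕP.≤-reflexive (exponent a)))
        (∣ₛ-p^-⊛ (suc a ℕ.+ suc a) 1 (∣ₛ-p^-⊛ (suc a) (suc a) p^ₐ₊₁∣Y p^ₐ₊₁∣Y)
                  (∣ₛ-⊕ (subst (_∣ₛ P ⊛ T) (sym (ℕP.*-identityʳ p)) (∣ₛ-const⊛ p T))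
                        (∣ₛ-⊛ʳ R (∣ₛ-p^-weaken {1} {suc a} (s≤s z≤n) p^ₐ₊₁∣Y))))
        where
        p^ₐ₊₁∣Y : p ^ suc a ∣ₛ Y
        p^ₐ₊₁∣Y = ∣ₛ-const⊛ (p ^ suc a) F
        exponent : ∀ a → 3 ℕ.+ (a ℕ.+ a) ≡ (suc a ℕ.+ suc a) ℕ.+ 1
        exponent = ℕ-solve-∀
      Z = proj₁ (∣ₛ-quotient p³⁺ᵃ∣rest)
      PY≐ : P ⊛ Y ≐ p^ (2 ℕ.+ a) ⊛ F
      PY≐ = ≐-trans (≐-sym (⊛-assoc P (p^ (suc a)) F)) (⊛-congʳ F (≐-sym (p^-suc (suc a))))
      p³⁺ᵃ≐ : p^ (3 ℕ.+ a) ≐ p^ (2 ℕ.+ a) ⊛ P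
      p³⁺ᵃ≐ = ≐-trans (p^-suc (2 ℕ.+ a)) (⊛-comm P (p^ (2 ℕ.+ a)))
      factor-Y² : ∀ P T Y R → ((𝟙 ⊕ P ⊛ Y) ⊕ (P ⊛ T) ⊛ (Y ⊛ Y)) ⊕ (Y ⊛ (Y ⊛ Y)) ⊛ R
                              ≐ (𝟙 ⊕ P ⊛ Y) ⊕ (Y ⊛ Y) ⊛ (P ⊛ T ⊕ Y ⊛ R)
      factor-Y² = solve 4 (λ P T Y R → ((con 1ℤ :+ P :* Y) :+ (P :* T) :* (Y :* Y)) :+ (Y :* (Y :* Y)) :* R
                                     := (con 1ℤ :+ P :* Y) :+ (Y :* Y) :* (P :* T :+ Y :* R)) (λ _ → refl)
      factor-p²⁺ᵃ : ∀ S F P Z → (𝟙 ⊕ S ⊛ F) ⊕ (S ⊛ P) ⊛ Z ≐ 𝟙 ⊕ S ⊛ (F ⊕ P ⊛ Z)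
      factor-p²⁺ᵃ = solve 4 (λ S F P Z → (con 1ℤ :+ S :* F) :+ (S :* P) :* Z := con 1ℤ :+ S :* (F :+ P :* Z)) (λ _ → refl)

    pow-p^-1+pE : ∀ E v → Σ[ E′ ∈ Series ] pow (𝟙 ⊕ P ⊛ E) (p ^ v) ≐ 𝟙 ⊕ p^ (suc v) ⊛ (E ⊕ P ⊛ E′)
    pow-p^-1+pE E zero = const 0ℤ , (begin
      one ⊛ (𝟙 ⊕ P ⊛ E)                    ≈⟨ ⊛-identityˡ (𝟙 ⊕ P ⊛ E) ⟩
      𝟙 ⊕ P ⊛ E
        ≈⟨ solve 2 (λ P E → con 1ℤ :+ P :* E := con 1ℤ :+ P :* (E :+ P :* con 0ℤ)) (λ _ → refl) P E ⟩
      𝟙 ⊕ P ⊛ (E ⊕ P ⊛ const 0ℤ)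
        ≈⟨ ⊕-congˡ 𝟙 (⊛-congʳ (E ⊕ P ⊛ const 0ℤ) (const-cong (cong +_ (sym (ℕP.*-identityʳ p))))) ⟩
      𝟙 ⊕ p^ 1 ⊛ (E ⊕ P ⊛ const 0ℤ)        ∎)
      where open ≐-Reasoning
    pow-p^-1+pE E (suc v) = E′ ⊕ Z , (begin
      pow f (p ℕ.* p ^ v)                            ≈⟨ pow-*-comm f p (p ^ v) ⟩
      pow (pow f (p ^ v)) p                          ≈⟨ pow-cong p (proj₂ (pow-p^-1+pE E v)) ⟩
      pow (𝟙 ⊕ p^ (suc v) ⊛ F) p                     ≈⟨ proj₂ (pow-p-1+p^F v F) ⟩
      𝟙 ⊕ p^ (2 ℕ.+ v) ⊛ (F ⊕ P ⊛ Z)                 ≈⟨ ⊕-congˡ 𝟙 (⊛-congˡ (p^ (2 ℕ.+ v)) (regroup P E E′ Z)) ⟩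
      𝟙 ⊕ p^ (2 ℕ.+ v) ⊛ (E ⊕ P ⊛ (E′ ⊕ Z))          ∎)
      where
      open ≐-Reasoning
      f = 𝟙 ⊕ P ⊛ E
      E′ = proj₁ (pow-p^-1+pE E v)
      F = E ⊕ P ⊛ E′
      Z = proj₁ (pow-p-1+p^F v F)
      regroup : ∀ P E E′ Z → (E ⊕ P ⊛ E′) ⊕ P ⊛ Z ≐ E ⊕ P ⊛ (E′ ⊕ Z)
      regroup = solve 4 (λ P E E′ Z → (E :+ P :* E′) :+ P :* Z := E :+ P :* (E′ :+ Z)) (λ _ → refl)

    -- (1 + pE)^(p^v) = 1 + p^(v+1) F with F ≡ E (mod p); in its c-th power every term beyond the linear one
    -- is divisible by p^(2v+2).
    pow-1+pE-≡ : ∀ E e v → p ^ v ℕD.∣ e → pow (𝟙 ⊕ P ⊛ E) e ≐ 𝟙 ⊕ const (+ (p ℕ.* e)) ⊛ E [mod p ^ (2 ℕ.+ v) ]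
    pow-1+pE-≡ E _ v (ℕD.divides c refl) = ∣ₛ-resp-≐ (≐-sym difference)
      (∣ₛ-⊕ (∣ₛ-⊛ˡ C (∣ₛ-⊛ʳ E′ (∣ₛ-resp-≐ (p^-suc (suc v)) (∣ₛ-const (p ^ (2 ℕ.+ v))))))
            (∣ₛ-⊛ʳ (T ⊕ Y ⊛ R) (∣ₛ-p^-weaken (s≤s (ℕP.m≤n+m (suc v) v))
                                               (∣ₛ-p^-⊛ (suc v) (suc v) p^ᵥ₊₁∣Y p^ᵥ₊₁∣Y))))
      where
      f = 𝟙 ⊕ P ⊛ E
      E′ = proj₁ (pow-p^-1+pE E v)
      Y = p^ (suc v) ⊛ (E ⊕ P ⊛ E′)
      R = proj₁ (binomial-secondOrder Y c)
      C = const (+ c)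
      T = const (+ choose2 c)
      p^ᵥ₊₁∣Y : p ^ suc v ∣ₛ Y
      p^ᵥ₊₁∣Y = ∣ₛ-const⊛ (p ^ suc v) (E ⊕ P ⊛ E′)
      pe≐ : const (+ (p ℕ.* (c ℕ.* p ^ v))) ≐ C ⊛ p^ (suc v)
      pe≐ = ≐-trans (const-cong (cong +_ (x∙yz≈y∙xz p c (p ^ v)))) (const-ℕ* c (p ^ suc v))
      difference : pow f (c ℕ.* p ^ v) ⊕ ⊖ (𝟙 ⊕ const (+ (p ℕ.* (c ℕ.* p ^ v))) ⊛ E)
                   ≐ C ⊛ ((P ⊛ p^ (suc v)) ⊛ E′) ⊕ (Y ⊛ Y) ⊛ (T ⊕ Y ⊛ R)
      difference = begin
        pow f (c ℕ.* p ^ v) ⊕ ⊖ (𝟙 ⊕ const (+ (p ℕ.* (c ℕ.* p ^ v))) ⊛ E)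
          ≈⟨ ⊕-cong (≐-trans (pow-*-comm f c (p ^ v))
                      (≐-trans (pow-cong c (proj₂ (pow-p^-1+pE E v))) (proj₂ (binomial-secondOrder Y c))))
                    (⊖-cong (⊕-congˡ 𝟙 (⊛-congʳ E pe≐))) ⟩
        secondOrder c Y R ⊕ ⊖ (𝟙 ⊕ (C ⊛ p^ (suc v)) ⊛ E)
          ≈⟨ split C Y T R ((C ⊛ p^ (suc v)) ⊛ E) ⟩
        (C ⊛ Y ⊕ ⊖ ((C ⊛ p^ (suc v)) ⊛ E)) ⊕ (Y ⊛ Y) ⊛ (T ⊕ Y ⊛ R)
          ≈⟨ ⊕-congʳ ((Y ⊛ Y) ⊛ (T ⊕ Y ⊛ R)) (cancel C (p^ (suc v)) E P E′) ⟩
        C ⊛ ((P ⊛ p^ (suc v)) ⊛ E′) ⊕ (Y ⊛ Y) ⊛ (T ⊕ Y ⊛ R) ∎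
        where
        open ≐-Reasoning
        split : ∀ C Y T R Q → (((𝟙 ⊕ C ⊛ Y) ⊕ T ⊛ (Y ⊛ Y)) ⊕ (Y ⊛ (Y ⊛ Y)) ⊛ R) ⊕ ⊖ (𝟙 ⊕ Q)
                              ≐ (C ⊛ Y ⊕ ⊖ Q) ⊕ (Y ⊛ Y) ⊛ (T ⊕ Y ⊛ R)
        split = solve 5 (λ C Y T R Q → (((con 1ℤ :+ C :* Y) :+ T :* (Y :* Y)) :+ (Y :* (Y :* Y)) :* R) :+ (:- (con 1ℤ :+ Q))
                                      := (C :* Y :+ (:- Q)) :+ (Y :* Y) :* (T :+ Y :* R)) (λ _ → refl)
        cancel : ∀ C V E P E′ → C ⊛ (V ⊛ (E ⊕ P ⊛ E′)) ⊕ ⊖ ((C ⊛ V) ⊛ E) ≐ C ⊛ ((P ⊛ V) ⊛ E′)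
        cancel = solve 5 (λ C V E P E′ → C :* (V :* (E :+ P :* E′)) :+ (:- ((C :* V) :* E)) := C :* ((P :* V) :* E′)) (λ _ → refl)


module OddPrime (r : ℕ) (isPrime : Prime (suc (suc (suc r)))) where

  open PowerSeries
  open import Defs
  open import Data.Nat as ℕ using (ℕ; zero; suc; _∸_; z≤n; s≤s; _^_)
  import Data.Nat.Properties as ℕP
  import Data.Nat.Divisibility as ℕD
  open import Data.Nat.DivMod using (_%_; _/_; m≡m%n+[m/n]*n; m%n<n; m<n⇒m%n≡m; [m+n]%n≡m%n; [m+kn]%n≡m%n)
  open import Relation.Binary.Definitions using (tri<; tri≈; tri>)
  open import Data.Nat.Induction using (<-rec)
  open import Data.Nat.Primality using (Prime; euclidsLemma; prime⇒irreducible)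
  open import Data.Integer as ℤ using (ℤ; +_; -[1+_]; _+_; _*_; _-_; -_; 0ℤ; 1ℤ; ∣_∣)
  import Data.Integer.Properties as ℤP
  open import Data.Integer.Divisibility.Signed as ℤD using (divides) renaming (_∣_ to _∣ℤ_)
  open import Data.Integer.Tactic.RingSolver using (solve-∀)
  open import Data.Nat.Tactic.RingSolver using () renaming (solve-∀ to ℕ-solve-∀)
  open import Data.Product using (Σ-syntax; _×_; _,_; proj₁; proj₂)
  open import Data.Sum using (_⊎_; inj₁; inj₂; [_,_]′)
  open import Data.Empty using (⊥-elim)
  open import Relation.Nullary using (yes; no; ¬_)
  open import Relation.Binary.PropositionalEquality
  open import Function using (_∘_)

  -- p is written 3 + r so that NonZero p and 1 < p hold by computation.
  p : ℕ
  p = suc (suc (suc r))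

  p^≢0 : ∀ N → ℕ.NonZero (p ^ N)
  p^≢0 N = ℕP.m^n≢0 p N

  p-odd : Σ[ t ∈ ℕ ] p ≡ suc (t ℕ.+ t)
  p-odd with p % 2 | m%n<n p 2 | m≡m%n+[m/n]*n p 2
  ... | 0 | _ | p≡[p/2]*2 with prime⇒irreducible isPrime (ℕD.divides (p / 2) p≡[p/2]*2)
  ...   | inj₁ ()
  ...   | inj₂ ()
  p-odd | suc (suc _) | s≤s (s≤s ()) | _
  p-odd | 1 | _ | p≡1+[p/2]*2 =
    p / 2 , trans p≡1+[p/2]*2 (cong suc (trans (ℕP.*-comm (p / 2) 2) (cong (p / 2 ℕ.+_) (ℕP.+-identityʳ (p / 2)))))

  open OddPowers p (proj₁ p-odd) (proj₂ p-odd) using (P; pow-1+pE-≡)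

  -- Binomial coefficients modulo p

  p∣ℤ-*⇒ : ∀ a b → + p ∣ℤ a * b → + p ∣ℤ a ⊎ + p ∣ℤ b
  p∣ℤ-*⇒ a b p∣ab with euclidsLemma ∣ a ∣ ∣ b ∣ isPrime (subst (p ℕD.∣_) (ℤP.abs-* a b) (ℤD.∣⇒∣ᵤ p∣ab))
  ... | inj₁ p∣a = inj₁ (ℤD.∣ᵤ⇒∣ p∣a)
  ... | inj₂ p∣b = inj₂ (ℤD.∣ᵤ⇒∣ p∣b)

  p∤digit : ∀ j → 1 ℕ.≤ j → j ℕ.< p → ¬ + p ∣ℤ + j
  p∤digit (suc j) _ j<p p∣j = ℕP.<⇒≱ j<p (ℕD.∣⇒≤ (ℤD.∣⇒∣ᵤ p∣j))

  p∤1 : ¬ + p ∣ℤ 1ℤ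
  p∤1 = p∤digit 1 (s≤s z≤n) (s≤s (s≤s z≤n))

  p∣altBinom-p : ∀ j → 1 ℕ.≤ j → j ℕ.< p → + p ∣ℤ altBinom p j
  p∣altBinom-p (suc j) 1≤j j<p with p∣ℤ-*⇒ (+ suc j) (altBinom p (suc j)) p∣j*binom
    where
    p∣j*binom : + p ∣ℤ + suc j * altBinom p (suc j)
    p∣j*binom = subst (+ p ∣ℤ_) (sym (altBinom-absorb (suc (suc r)) j))
                  (ℤD.∣m⇒∣m*n (altBinom (suc (suc r)) j) (ℤD.∣m⇒∣-m ℤD.∣-refl))
  ... | inj₁ p∣j = ⊥-elim (p∤digit (suc j) 1≤j j<p p∣j)
  ... | inj₂ p∣binom = p∣binom

  -- Telescoping: each difference altBinom (p-1) (i+1) - altBinom (p-1) i = altBinom p (i+1) is divisible by p.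
  altBinom-p∸1≡1 : ∀ i → i ℕ.≤ suc (suc r) → + p ∣ℤ altBinom (suc (suc r)) i - 1ℤ
  altBinom-p∸1≡1 zero _ = divides 0ℤ refl
  altBinom-p∸1≡1 (suc i) i<p∸1 = subst (+ p ∣ℤ_) (sym (telescope (altBinom (suc (suc r)) (suc i)) (altBinom (suc (suc r)) i)))
    (ℤD.∣m∣n⇒∣m+n (p∣altBinom-p (suc i) (s≤s z≤n) (s≤s i<p∸1)) (altBinom-p∸1≡1 i (ℕP.<⇒≤ i<p∸1)))
    where
    telescope : ∀ a b → a - 1ℤ ≡ (a - b) + (b - 1ℤ)
    telescope = solve-∀

  -- binomQuot j = C(p,j)(-1)^j / p for 0 < j < p: the coefficients of ((1 - x)^p - (1 - x^p)) / p.
  binomQuot : ℕ → ℤ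
  binomQuot j with + p ℤD.∣? altBinom p j
  ... | yes p∣binom = ℤD._∣_.quotient p∣binom
  ... | no _ = 0ℤ

  binomQuot-spec : ∀ j → 1 ℕ.≤ j → j ℕ.< p → altBinom p j ≡ binomQuot j * + p
  binomQuot-spec j 1≤j j<p with + p ℤD.∣? altBinom p j
  ... | yes p∣binom = ℤD._∣_.equality p∣binom
  ... | no p∤binom = ⊥-elim (p∤binom (p∣altBinom-p j 1≤j j<p))

  binomQuot-∤ : ∀ j → ¬ + p ∣ℤ altBinom p j → binomQuot j ≡ 0ℤ
  binomQuot-∤ j p∤binom with + p ℤD.∣? altBinom p j
  ... | yes p∣binom = ⊥-elim (p∤binom p∣binom)
  ... | no _ = refl

  binomQuot-0 : binomQuot 0 ≡ 0ℤ
  binomQuot-0 = binomQuot-∤ 0 p∤1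

  altBinom-p-p : altBinom p p ≡ - 1ℤ
  altBinom-p-p = subst (λ q → altBinom q q ≡ - 1ℤ) (sym (proj₂ p-odd)) (altBinom-odd-diag (proj₁ p-odd))

  binomQuot-≥p : ∀ j → p ℕ.≤ j → binomQuot j ≡ 0ℤ
  binomQuot-≥p j p≤j with + p ℤD.∣? altBinom p j | p ℕ.≟ j
  ... | no _ | _ = refl
  ... | yes p∣binom | yes refl = ⊥-elim (p∤1 (subst (+ p ∣ℤ_) (cong -_ altBinom-p-p) (ℤD.∣m⇒∣-m p∣binom)))
  ... | yes (divides q binom≡qp) | no p≢j =
    ℤP.*-cancelʳ-≡ q 0ℤ (+ p) (trans (sym binom≡qp) (altBinom-vanish p j (ℕP.≤∧≢⇒< p≤j p≢j)))

  binomQuot-inverse : ∀ j → 1 ℕ.≤ j → j ℕ.< p → + p ∣ℤ + j * binomQuot j + 1ℤ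
  binomQuot-inverse (suc j) 1≤j j<p = subst (+ p ∣ℤ_) (sym (negate j*quot≡ ))
    (ℤD.∣m⇒∣-m (altBinom-p∸1≡1 j (ℕP.<⇒≤ (ℕP.≤-pred j<p))))
    where
    j*quot≡ : + suc j * binomQuot (suc j) ≡ - altBinom (suc (suc r)) j
    j*quot≡ = ℤP.*-cancelʳ-≡ _ _ (+ p) (begin
      + suc j * binomQuot (suc j) * + p    ≡⟨ ℤP.*-assoc (+ suc j) (binomQuot (suc j)) (+ p) ⟩
      + suc j * (binomQuot (suc j) * + p)  ≡⟨ cong (+ suc j *_) (binomQuot-spec (suc j) 1≤j j<p) ⟨
      + suc j * altBinom p (suc j)         ≡⟨ altBinom-absorb (suc (suc r)) j ⟩
      - (+ p) * altBinom (suc (suc r)) j   ≡⟨ move-sign (+ p) (altBinom (suc (suc r)) j) ⟩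
      - altBinom (suc (suc r)) j * + p     ∎)
      where
      open ≡-Reasoning
      move-sign : ∀ a b → - a * b ≡ - b * a
      move-sign = solve-∀
    negate : ∀ {x} → x ≡ - altBinom (suc (suc r)) j → x + 1ℤ ≡ - (altBinom (suc (suc r)) j - 1ℤ)
    negate refl = flip (altBinom (suc (suc r)) j)
      where
      flip : ∀ b → - b + 1ℤ ≡ - (b - 1ℤ)
      flip = solve-∀

  altBinom-p-split : ∀ j → altBinom p j ≡ oneMinus p j + + p * binomQuot j
  altBinom-p-split zero rewrite binomQuot-0 | ℤP.*-zeroʳ (+ p) = refl
  altBinom-p-split (suc j) with suc j ℕ.<? p | p ℕ.≟ suc j
  ... | yes j<p | _ = begin
    altBinom p (suc j)                           ≡⟨ binomQuot-spec (suc j) (s≤s z≤n) j<p ⟩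
    binomQuot (suc j) * + p                      ≡⟨ ℤP.*-comm (binomQuot (suc j)) (+ p) ⟩
    + p * binomQuot (suc j)                      ≡⟨ ℤP.+-identityˡ _ ⟨
    0ℤ + + p * binomQuot (suc j)                 ≡⟨ cong (_+ + p * binomQuot (suc j)) (oneMinus-off p j (ℕP.<⇒≢ j<p ∘ sym)) ⟨
    oneMinus p (suc j) + + p * binomQuot (suc j) ∎
    where open ≡-Reasoning
  ... | no _ | yes refl rewrite binomQuot-≥p p ℕP.≤-refl | oneMinus-diag (suc (suc r)) | ℤP.*-zeroʳ (+ p) = altBinom-p-p
  ... | no j≮p | no p≢1+j
    rewrite binomQuot-≥p (suc j) (ℕP.≮⇒≥ j≮p) | oneMinus-off p j p≢1+j | ℤP.*-zeroʳ (+ p) =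
      altBinom-vanish p (suc j) (ℕP.≤∧≢⇒< (ℕP.≮⇒≥ j≮p) p≢1+j)

  pow-oneMinus-p : ∀ K .{{_ : ℕ.NonZero K}} → pow (oneMinus K) p ≐ oneMinus (p ℕ.* K) ⊕ P ⊛ (binomQuot ∘x^ K)
  pow-oneMinus-p K = ≐-trans (pow-oneMinus≐ K p) (≐-sym (≐-∘x^ (altBinom p) K on-mult off-mult))
    where
    on-mult : ∀ j → (oneMinus (p ℕ.* K) ⊕ P ⊛ (binomQuot ∘x^ K)) (j ℕ.* K) ≡ altBinom p j
    on-mult j = trans (cong₂ _+_ (oneMinus-*-mult p K j)
                        (trans (const-⊛ (+ p) (binomQuot ∘x^ K) (j ℕ.* K)) (cong (+ p *_) (∘x^-mult binomQuot K j))))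
                      (sym (altBinom-p-split j))
    off-mult : ∀ n → ¬ K ℕD.∣ n → (oneMinus (p ℕ.* K) ⊕ P ⊛ (binomQuot ∘x^ K)) n ≡ 0ℤ
    off-mult n K∤n = trans (cong₂ _+_ (oneMinus-*-∤ p K n K∤n)
                             (trans (const-⊛ (+ p) (binomQuot ∘x^ K) n) (cong (+ p *_) (∘x^-∤ binomQuot K n K∤n))))
                           (trans (ℤP.+-identityˡ (+ p * 0ℤ)) (ℤP.*-zeroʳ (+ p)))

  -- By binomQuot-inverse, recipDigit j is an inverse of j modulo p whenever p ∤ j.
  recipDigit : ℕ → ℤ
  recipDigit j = - binomQuot (j % p)

  oneMinus-p-⊛-recipDigit : ∀ j → (oneMinus p ⊛ recipDigit) j ≡ - binomQuot j
  oneMinus-p-⊛-recipDigit j with j ℕ.<? p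
  ... | yes j<p = trans (oneMinus-⊛-below p recipDigit j j<p) (cong (λ i → - binomQuot i) (m<n⇒m%n≡m j<p))
  ... | no j≮p = begin
    (oneMinus p ⊛ recipDigit) j                       ≡⟨ oneMinus-⊛-above p recipDigit j p≤j ⟩
    - binomQuot (j % p) - - binomQuot ((j ∸ p) % p)   ≡⟨ cong (λ i → - binomQuot i - - binomQuot ((j ∸ p) % p)) j%p≡ ⟩
    - binomQuot ((j ∸ p) % p) - - binomQuot ((j ∸ p) % p) ≡⟨ ℤP.+-inverseʳ (- binomQuot ((j ∸ p) % p)) ⟩
    0ℤ                                                ≡⟨ cong -_ (binomQuot-≥p j p≤j) ⟨
    - binomQuot j                                     ∎
    where
    open ≡-Reasoning
    p≤j = ℕP.≮⇒≥ j≮p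
    j%p≡ : j % p ≡ (j ∸ p) % p
    j%p≡ = trans (cong (_% p) (sym (ℕP.m∸n+n≡m p≤j))) ([m+n]%n≡m%n (j ∸ p) p)

  oneMinus-pK-⊛-recipDigit : ∀ K .{{_ : ℕ.NonZero K}} → oneMinus (p ℕ.* K) ⊛ (recipDigit ∘x^ K) ≐ ⊖ (binomQuot ∘x^ K)
  oneMinus-pK-⊛-recipDigit K = ≐-trans (oneMinus-*-⊛-∘x^ p K recipDigit) (≐-sym (≐-∘x^ (oneMinus p ⊛ recipDigit) K
    (λ j → trans (cong -_ (∘x^-mult binomQuot K j)) (sym (oneMinus-p-⊛-recipDigit j)))
    (λ n K∤n → cong -_ (∘x^-∤ binomQuot K n K∤n))))

  open ⊛-Solver using (solve; _:=_; _:+_; _:*_; :-_; con)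

  -- The factors φ and their product

  -- f ≈1+p S means f = 1 + pA with A ≡ S (mod p), so that f ≡ 1 + pS (mod p²).
  infix 4 _≈1+p_
  _≈1+p_ : Series → Series → Set
  f ≈1+p S = Σ[ A ∈ Series ] (f ≐ 𝟙 ⊕ P ⊛ A) × (A ≐ S [mod p ])

  ≈1+p-⊛ : ∀ {f g S T} → f ≈1+p S → g ≈1+p T → f ⊛ g ≈1+p S ⊕ T
  ≈1+p-⊛ {f} {g} {S} {T} (A , f≐ , A≡S) (B , g≐ , B≡T) = (A ⊕ B) ⊕ P ⊛ (A ⊛ B) ,
    ≐-trans (⊛-cong f≐ g≐) (solve 3 (λ P A B → (con 1ℤ :+ P :* A) :* (con 1ℤ :+ P :* B)
                                             := con 1ℤ :+ P :* ((A :+ B) :+ P :* (A :* B))) (λ _ → refl) P A B) ,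
    ∣ₛ-resp-≐ (≐-sym (regroup A B S T P)) (∣ₛ-⊕ (∣ₛ-⊕ A≡S B≡T) (∣ₛ-const⊛ p (A ⊛ B)))
    where
    regroup : ∀ A B S T P → ((A ⊕ B) ⊕ P ⊛ (A ⊛ B)) ⊕ ⊖ (S ⊕ T) ≐ ((A ⊕ ⊖ S) ⊕ (B ⊕ ⊖ T)) ⊕ P ⊛ (A ⊛ B)
    regroup = solve 5 (λ A B S T P → ((A :+ B) :+ P :* (A :* B)) :+ (:- (S :+ T))
                                   := ((A :+ (:- S)) :+ (B :+ (:- T))) :+ P :* (A :* B)) (λ _ → refl)

  ≈1+p-inverse : ∀ {f g S} → f ≈1+p S → g ⊛ f ≐ 𝟙 → g ≈1+p ⊖ S
  ≈1+p-inverse {f} {g} {S} (A , f≐ , A≡S) g⊛f≐𝟙 = ⊖ A ⊕ P ⊛ X ,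
    inverse-1+PW P A g (≐-trans (⊛-congˡ g (≐-sym f≐)) g⊛f≐𝟙) ,
    ∣ₛ-resp-≐ (≐-sym (regroup A S P X)) (∣ₛ-⊕ (∣ₛ-⊖ A≡S) (∣ₛ-const⊛ p X))
    where
    X = g ⊛ (A ⊛ A)
    regroup : ∀ A S P X → (⊖ A ⊕ P ⊛ X) ⊕ ⊖ (⊖ S) ≐ ⊖ (A ⊕ ⊖ S) ⊕ P ⊛ X
    regroup = solve 4 (λ A S P X → (:- A :+ P :* X) :+ (:- (:- S)) := (:- (A :+ (:- S))) :+ P :* X) (λ _ → refl)

  φ : ℕ → Series
  φ K = oneMinus (p ℕ.* K) ⊛ pow (geom K) p

  φ-⊛-1+pW : ∀ K .{{_ : ℕ.NonZero K}} → φ K ⊛ (𝟙 ⊕ P ⊛ ((binomQuot ∘x^ K) ⊛ geom (p ℕ.* K))) ≐ 𝟙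
  φ-⊛-1+pW K = begin
    φ K ⊛ (𝟙 ⊕ P ⊛ (B ⊛ Gp))
      ≈⟨ ⊛-congˡ (φ K) (⊕-congʳ (P ⊛ (B ⊛ Gp)) (≐-sym (≐-trans (oneMinus-⊛-geom (p ℕ.* K) {{pK≢0}}) one≐𝟙))) ⟩
    φ K ⊛ (Op ⊛ Gp ⊕ P ⊛ (B ⊛ Gp))            ≈⟨ ⊛-congˡ (φ K) (factor Op P B Gp) ⟩
    φ K ⊛ ((Op ⊕ P ⊛ B) ⊛ Gp)                 ≈⟨ ⊛-congˡ (φ K) (⊛-congʳ Gp (≐-sym (pow-oneMinus-p K))) ⟩
    (Op ⊛ pow (geom K) p) ⊛ (pow (oneMinus K) p ⊛ Gp)
                                              ≈⟨ regroup Op (pow (geom K) p) (pow (oneMinus K) p) Gp ⟩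
    (Op ⊛ Gp) ⊛ (pow (geom K) p ⊛ pow (oneMinus K) p)
                                              ≈⟨ ⊛-cong (oneMinus-⊛-geom (p ℕ.* K) {{pK≢0}}) (pow-inverse p (geom-⊛-oneMinus K)) ⟩
    one ⊛ one                                 ≈⟨ ⊛-identityˡ one ⟩
    one                                       ≈⟨ one≐𝟙 ⟩
    𝟙                                         ∎
    where
    open ≐-Reasoning
    pK≢0 = ℕP.m*n≢0 p K
    Op = oneMinus (p ℕ.* K)
    Gp = geom (p ℕ.* K)
    B = binomQuot ∘x^ K
    factor : ∀ O P B G → O ⊛ G ⊕ P ⊛ (B ⊛ G) ≐ (O ⊕ P ⊛ B) ⊛ G
    factor = solve 4 (λ O P B G → O :* G :+ P :* (B :* G) := (O :+ P :* B) :* G) (λ _ → refl)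
    regroup : ∀ a b c d → (a ⊛ b) ⊛ (c ⊛ d) ≐ (a ⊛ d) ⊛ (b ⊛ c)
    regroup = solve 4 (λ a b c d → (a :* b) :* (c :* d) := (a :* d) :* (b :* c)) (λ _ → refl)

  recipDigit∘x^≐ : ∀ K .{{_ : ℕ.NonZero K}} → recipDigit ∘x^ K ≐ ⊖ ((binomQuot ∘x^ K) ⊛ geom (p ℕ.* K))
  recipDigit∘x^≐ K = begin
    R                              ≈⟨ ⊛-identityˡ R ⟨
    one ⊛ R                        ≈⟨ ⊛-congʳ R (geom-⊛-oneMinus (p ℕ.* K) {{pK≢0}}) ⟨
    (Gp ⊛ Op) ⊛ R                  ≈⟨ ⊛-assoc Gp Op R ⟩
    Gp ⊛ (Op ⊛ R)                  ≈⟨ ⊛-congˡ Gp (oneMinus-pK-⊛-recipDigit K) ⟩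
    Gp ⊛ (⊖ B)                     ≈⟨ solve 2 (λ G B → G :* (:- B) := :- (B :* G)) (λ _ → refl) Gp B ⟩
    ⊖ (B ⊛ Gp)                     ∎
    where
    open ≐-Reasoning
    pK≢0 = ℕP.m*n≢0 p K
    Op = oneMinus (p ℕ.* K)
    Gp = geom (p ℕ.* K)
    B = binomQuot ∘x^ K
    R = recipDigit ∘x^ K

  φ≈1+p : ∀ K .{{_ : ℕ.NonZero K}} → φ K ≈1+p recipDigit ∘x^ K
  φ≈1+p K = ⊖ W ⊕ P ⊛ X , inverse-1+PW P W (φ K) (φ-⊛-1+pW K) ,
    ∣ₛ-resp-≐ (≐-sym (≐-trans (⊕-congˡ (⊖ W ⊕ P ⊛ X) (⊖-cong (recipDigit∘x^≐ K))) (cancel W P X))) (∣ₛ-const⊛ p X)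
    where
    W = (binomQuot ∘x^ K) ⊛ geom (p ℕ.* K)
    X = φ K ⊛ (W ⊛ W)
    cancel : ∀ W P X → (⊖ W ⊕ P ⊛ X) ⊕ ⊖ (⊖ W) ≐ P ⊛ X
    cancel = solve 3 (λ W P X → (:- W :+ P :* X) :+ (:- (:- W)) := P :* X) (λ _ → refl)

  -- Q N = Π_{i<N} (1 - x^(p^i))^(-(p-1)), so that 1/(1 - x) · Q N is the truncated generating function of d₁.
  Q : ℕ → Series
  Q zero = one
  Q (suc N) = Q N ⊛ pow (geom (p ^ N)) (suc (suc r))

  G : ℕ → Series
  G N = geom 1 ⊛ Q N

  Φ : ℕ → Series
  Φ zero = one
  Φ (suc N) = Φ N ⊛ φ (p ^ N)

  G⊛oneMinus≐Φ : ∀ N → G N ⊛ oneMinus (p ^ N) ≐ Φ N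
  G⊛oneMinus≐Φ zero = ≐-trans (⊛-congʳ (oneMinus 1) (⊛-identityʳ (geom 1))) (geom-⊛-oneMinus 1)
  G⊛oneMinus≐Φ (suc N) = ≐-sym (begin
    Φ N ⊛ φ (p ^ N)                                 ≈⟨ ⊛-congʳ (φ (p ^ N)) (≐-sym (G⊛oneMinus≐Φ N)) ⟩
    ((geom 1 ⊛ Q N) ⊛ O) ⊛ (O′ ⊛ (B ⊛ E))           ≈⟨ regroup (geom 1) (Q N) O O′ B E ⟩
    ((geom 1 ⊛ (Q N ⊛ B)) ⊛ O′) ⊛ (E ⊛ O)
      ≈⟨ ⊛-congˡ ((geom 1 ⊛ (Q N ⊛ B)) ⊛ O′) (geom-⊛-oneMinus (p ^ N) {{p^≢0 N}}) ⟩
    ((geom 1 ⊛ (Q N ⊛ B)) ⊛ O′) ⊛ one               ≈⟨ ⊛-identityʳ ((geom 1 ⊛ (Q N ⊛ B)) ⊛ O′) ⟩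
    (geom 1 ⊛ (Q N ⊛ B)) ⊛ O′                       ∎)
    where
    open ≐-Reasoning
    O = oneMinus (p ^ N)
    O′ = oneMinus (p ^ suc N)
    B = pow (geom (p ^ N)) (suc (suc r))
    E = geom (p ^ N)
    regroup : ∀ g q c d b e → ((g ⊛ q) ⊛ c) ⊛ (d ⊛ (b ⊛ e)) ≐ ((g ⊛ (q ⊛ b)) ⊛ d) ⊛ (e ⊛ c)
    regroup = solve 6 (λ g q c d b e → ((g :* q) :* c) :* (d :* (b :* e)) := ((g :* (q :* b)) :* d) :* (e :* c)) (λ _ → refl)

  G≐geom⊛Φ : ∀ N → G N ≐ geom (p ^ N) ⊛ Φ N
  G≐geom⊛Φ N = begin
    G N                                        ≈⟨ ⊛-identityʳ (G N) ⟨
    G N ⊛ one                                  ≈⟨ ⊛-congˡ (G N) (oneMinus-⊛-geom (p ^ N) {{p^≢0 N}}) ⟨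
    G N ⊛ (oneMinus (p ^ N) ⊛ geom (p ^ N))    ≈⟨ ⊛-assoc (G N) (oneMinus (p ^ N)) (geom (p ^ N)) ⟨
    (G N ⊛ oneMinus (p ^ N)) ⊛ geom (p ^ N)    ≈⟨ ⊛-congʳ (geom (p ^ N)) (G⊛oneMinus≐Φ N) ⟩
    Φ N ⊛ geom (p ^ N)                         ≈⟨ ⊛-comm (Φ N) (geom (p ^ N)) ⟩
    geom (p ^ N) ⊛ Φ N                         ∎
    where open ≐-Reasoning

  digitSum : ℕ → Series
  digitSum N n = Σ< (λ i → (recipDigit ∘x^ (p ^ i)) n) N

  Φ≈1+p : ∀ N → Φ N ≈1+p digitSum N
  Φ≈1+p zero = const 0ℤ ,
    ≐-trans one≐𝟙 (solve 1 (λ P → con 1ℤ := con 1ℤ :+ P :* con 0ℤ) (λ _ → refl) P) ,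
    λ { zero → divides 0ℤ refl ; (suc n) → divides 0ℤ refl }
  Φ≈1+p (suc N) = ≈1+p-⊛ (Φ≈1+p N) (φ≈1+p (p ^ N) {{p^≢0 N}})

  Q′ : ℕ → Series
  Q′ zero = one
  Q′ (suc N) = Q′ N ⊛ pow (oneMinus (p ^ N)) (suc (suc r))

  H : ℕ → Series
  H N = oneMinus 1 ⊛ Q′ N

  H⊛G≐one : ∀ N → H N ⊛ G N ≐ one
  H⊛G≐one N = ≐-trans (interchange⊛ (oneMinus 1) (Q′ N) (geom 1) (Q N))
    (≐-trans (⊛-cong (oneMinus-⊛-geom 1) (Q′⊛Q≐one N)) (⊛-identityˡ one))
    where
    interchange⊛ : ∀ a b c d → (a ⊛ b) ⊛ (c ⊛ d) ≐ (a ⊛ c) ⊛ (b ⊛ d)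
    interchange⊛ = solve 4 (λ a b c d → (a :* b) :* (c :* d) := (a :* c) :* (b :* d)) (λ _ → refl)
    Q′⊛Q≐one : ∀ N → Q′ N ⊛ Q N ≐ one
    Q′⊛Q≐one zero = ⊛-identityˡ one
    Q′⊛Q≐one (suc N) = ≐-trans (interchange⊛ (Q′ N) (pow (oneMinus (p ^ N)) (suc (suc r))) (Q N) (pow (geom (p ^ N)) (suc (suc r))))
      (≐-trans (⊛-cong {Q′ N ⊛ Q N} {one} (Q′⊛Q≐one N) (pow-inverse (suc (suc r)) (oneMinus-⊛-geom (p ^ N) {{p^≢0 N}})))
               (⊛-identityˡ one))

  H≐oneMinus⊛Ψ : ∀ N → H N ≐ oneMinus (p ^ N) ⊛ (H N ⊛ geom (p ^ N))
  H≐oneMinus⊛Ψ N = begin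
    H N                                        ≈⟨ ⊛-identityʳ (H N) ⟨
    H N ⊛ one                                  ≈⟨ ⊛-congˡ (H N) (geom-⊛-oneMinus (p ^ N) {{p^≢0 N}}) ⟨
    H N ⊛ (geom (p ^ N) ⊛ oneMinus (p ^ N))
      ≈⟨ solve 3 (λ h g o → h :* (g :* o) := o :* (h :* g)) (λ _ → refl) (H N) (geom (p ^ N)) (oneMinus (p ^ N)) ⟩
    oneMinus (p ^ N) ⊛ (H N ⊛ geom (p ^ N))    ∎
    where open ≐-Reasoning

  H⊛geom≈1+p : ∀ N → H N ⊛ geom (p ^ N) ≈1+p ⊖ digitSum N
  H⊛geom≈1+p N = ≈1+p-inverse (Φ≈1+p N) (begin
    (H N ⊛ geom (p ^ N)) ⊛ Φ N    ≈⟨ ⊛-assoc (H N) (geom (p ^ N)) (Φ N) ⟩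
    H N ⊛ (geom (p ^ N) ⊛ Φ N)    ≈⟨ ⊛-congˡ (H N) (G≐geom⊛Φ N) ⟨
    H N ⊛ G N                     ≈⟨ H⊛G≐one N ⟩
    one                           ≈⟨ one≐𝟙 ⟩
    𝟙                             ∎)
    where open ≐-Reasoning

  -- The congruence d_m(n) ≡ p m S_n

  prodTo-pos : ∀ e N → prodTo p (+ e) N ≐ pow (Q N) e
  prodTo-pos e zero = ≐-sym (pow-one e)
  prodTo-pos e (suc N) = begin
    prodTo p (+ e) N ⊛ invPow (p ^ N) (+ suc (suc r) * + e)
      ≈⟨ ⊛-cong (prodTo-pos e N) (≐-trans (λ n → cong (λ c → invPow (p ^ N) c n) (sym (ℤP.pos-* (suc (suc r)) e)))
                                           (pow-* (geom (p ^ N)) (suc (suc r)) e)) ⟩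
    pow (Q N) e ⊛ pow (pow (geom (p ^ N)) (suc (suc r))) e
      ≈⟨ pow-distrib-⊛ (Q N) (pow (geom (p ^ N)) (suc (suc r))) e ⟨
    pow (Q (suc N)) e ∎
    where open ≐-Reasoning

  prodTo-neg : ∀ j N → prodTo p -[1+ j ] N ≐ pow (Q′ N) (suc j)
  prodTo-neg j zero = ≐-sym (pow-one (suc j))
  prodTo-neg j (suc N) = begin
    prodTo p -[1+ j ] N ⊛ pow (oneMinus (p ^ N)) (suc (suc r) ℕ.* suc j)
      ≈⟨ ⊛-cong (prodTo-neg j N) (pow-* (oneMinus (p ^ N)) (suc (suc r)) (suc j)) ⟩
    pow (Q′ N) (suc j) ⊛ pow (pow (oneMinus (p ^ N)) (suc (suc r))) (suc j)
      ≈⟨ pow-distrib-⊛ (Q′ N) (pow (oneMinus (p ^ N)) (suc (suc r))) (suc j) ⟨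
    pow (Q′ (suc N)) (suc j) ∎
    where open ≐-Reasoning

  d-pos : ∀ e n → d p (+ e) n ≡ pow (G (suc n)) e n
  d-pos e n = trans (⊛-congˡ (pow (geom 1) e) (prodTo-pos e (suc n)) n) (sym (pow-distrib-⊛ (geom 1) (Q (suc n)) e n))

  d-neg : ∀ j n → d p -[1+ j ] n ≡ pow (H (suc n)) (suc j) n
  d-neg j n = trans (⊛-congˡ (pow (oneMinus 1) (suc j)) (prodTo-neg j (suc n)) n)
                    (sym (pow-distrib-⊛ (oneMinus 1) (Q′ (suc n)) (suc j) n))

  infix 4 _≡_[modℤ_]
  _≡_[modℤ_] : ℤ → ℤ → ℕ → Set
  a ≡ b [modℤ q ] = + q ∣ℤ a - b

  ≡mod-p*m* : ∀ v m a x y → + (p ^ v) ∣ℤ m → + p ∣ℤ x - y →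
    a ≡ + p * m * x [modℤ p ^ (2 ℕ.+ v) ] → a ≡ + p * m * y [modℤ p ^ (2 ℕ.+ v) ]
  ≡mod-p*m* v _ a x y (divides k refl) (divides l x-y≡lp) a≡pmx =
    subst (+ (p ^ (2 ℕ.+ v)) ∣ℤ_) (sym (split a x y (+ p) M)) (ℤD.∣m∣n⇒∣m+n a≡pmx p²⁺ᵛ∣pm[x-y])
    where
    M = k * + (p ^ v)
    split : ∀ a x y P M → a - P * M * y ≡ (a - P * M * x) + P * M * (x - y)
    split = solve-∀
    regroup : ∀ P k Q l → P * (k * Q) * (l * P) ≡ (k * l) * (P * (P * Q))
    regroup = solve-∀
    p²⁺ᵛ≡ : + (p ^ (2 ℕ.+ v)) ≡ + p * (+ p * + (p ^ v))
    p²⁺ᵛ≡ = trans (ℤP.pos-* p (p ℕ.* p ^ v)) (cong (+ p *_) (ℤP.pos-* p (p ^ v)))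
    p²⁺ᵛ∣pm[x-y] : + (p ^ (2 ℕ.+ v)) ∣ℤ + p * M * (x - y)
    p²⁺ᵛ∣pm[x-y] rewrite x-y≡lp | regroup (+ p) k (+ (p ^ v)) l = ℤD.∣n⇒∣m*n (k * l) (ℤD.∣-reflexive p²⁺ᵛ≡)

  p^k<p^[1+k] : ∀ k → p ^ k ℕ.< p ^ suc k
  p^k<p^[1+k] k = subst (p ^ k ℕ.<_) (ℕP.*-comm (p ^ k) p) (ℕP.m<m*n (p ^ k) p {{p^≢0 k}} (s≤s (s≤s z≤n)))

  n<p^n : ∀ n → n ℕ.< p ^ n
  n<p^n zero = s≤s z≤n
  n<p^n (suc n) = ℕP.≤-<-trans (n<p^n n) (p^k<p^[1+k] n)

  n<p^[1+n] : ∀ n → n ℕ.< p ^ suc n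
  n<p^[1+n] n = ℕP.<-trans (n<p^n n) (p^k<p^[1+k] n)

  pow-≈1+p-coeff : ∀ {F Y T} M e v n → F ≡1-mod-x^ M → Y ≈1+p T → p ^ v ℕD.∣ e → suc n ℕ.< M →
    pow (F ⊛ Y) e (suc n) ≡ + p * + e * T (suc n) [modℤ p ^ (2 ℕ.+ v) ]
  pow-≈1+p-coeff {F} {Y} {T} M e v n F≡1 (A , Y≐ , A≡T) p^v∣e n<M =
    ≡mod-p*m* v (+ e) (pow (F ⊛ Y) e (suc n)) (A (suc n)) (T (suc n)) (ℤD.∣ᵤ⇒∣ p^v∣e) (A≡T (suc n))
      (subst₂ (λ a b → a ≡ b [modℤ p ^ (2 ℕ.+ v) ]) (sym coeff) linear (pow-1+pE-≡ A e v p^v∣e (suc n)))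
    where
    coeff : pow (F ⊛ Y) e (suc n) ≡ pow (𝟙 ⊕ P ⊛ A) e (suc n)
    coeff = begin
      pow (F ⊛ Y) e (suc n)              ≡⟨ pow-distrib-⊛ F Y e (suc n) ⟩
      (pow F e ⊛ pow Y e) (suc n)        ≡⟨ ≡1-mod-x^-⊛-coeff (≡1-mod-x^-pow e F≡1) (pow Y e) (suc n) n<M ⟩
      pow Y e (suc n)                    ≡⟨ pow-cong e Y≐ (suc n) ⟩
      pow (𝟙 ⊕ P ⊛ A) e (suc n)          ∎
      where open ≡-Reasoning
    linear : (𝟙 ⊕ const (+ (p ℕ.* e)) ⊛ A) (suc n) ≡ + p * + e * A (suc n)
    linear = trans (ℤP.+-identityˡ _) (trans (const-⊛ (+ (p ℕ.* e)) A (suc n)) (cong (_* A (suc n)) (ℤP.pos-* p e)))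

  d≡p*m*digitSum : ∀ m → m ≢ 0ℤ → ∀ n v → p ^ v ℕD.∣ ∣ m ∣ →
    d p m (suc n) ≡ + p * m * digitSum (suc (suc n)) (suc n) [modℤ p ^ (2 ℕ.+ v) ]
  d≡p*m*digitSum (+ zero) m≢0 _ _ _ = ⊥-elim (m≢0 refl)
  d≡p*m*digitSum (+ suc e) _ n v p^v∣m =
    subst (λ a → a ≡ + p * + suc e * digitSum N (suc n) [modℤ p ^ (2 ℕ.+ v) ]) (sym d≡)
      (pow-≈1+p-coeff (p ^ N) (suc e) v n (geom-≡1-mod-x^ (p ^ N) {{p^≢0 N}}) (Φ≈1+p N) p^v∣m (n<p^[1+n] (suc n)))
    where
    N = suc (suc n)
    d≡ : d p (+ suc e) (suc n) ≡ pow (geom (p ^ N) ⊛ Φ N) (suc e) (suc n)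
    d≡ = trans (d-pos (suc e) (suc n)) (pow-cong (suc e) (G≐geom⊛Φ N) (suc n))
  d≡p*m*digitSum -[1+ j ] _ n v p^v∣m =
    subst₂ (λ a b → a ≡ b [modℤ p ^ (2 ℕ.+ v) ]) (sym d≡) (move-sign (+ p) (+ suc j) (digitSum N (suc n)))
      (pow-≈1+p-coeff (p ^ N) (suc j) v n (oneMinus-≡1-mod-x^ (p ^ N)) (H⊛geom≈1+p N) p^v∣m (n<p^[1+n] (suc n)))
    where
    N = suc (suc n)
    d≡ : d p -[1+ j ] (suc n) ≡ pow (oneMinus (p ^ N) ⊛ (H N ⊛ geom (p ^ N))) (suc j) (suc n)
    d≡ = trans (d-neg j (suc n)) (pow-cong (suc j) (H≐oneMinus⊛Ψ N) (suc n))
    move-sign : ∀ P J S → P * J * (- S) ≡ P * (- J) * S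
    move-sign = solve-∀

  -- The value of S_n

  recipDigit-p∣ : ∀ j → p ℕD.∣ j → recipDigit j ≡ 0ℤ
  recipDigit-p∣ j p∣j = trans (cong (λ i → - binomQuot i) (ℕD.n∣m⇒m%n≡0 j p p∣j)) (cong -_ binomQuot-0)

  p∤digits : ∀ ns q → 1 ℕ.≤ ns → ns ℕ.< p → ¬ p ℕD.∣ ns ℕ.+ p ℕ.* q
  p∤digits ns q 1≤ns ns<p p∣w = ℕP.<⇒≱ ns<p (ℕD.∣⇒≤ {{ℕ.>-nonZero 1≤ns}}
    (ℕD.∣m+n∣m⇒∣n (subst (p ℕD.∣_) (ℕP.+-comm ns (p ℕ.* q)) p∣w) (ℕD.m∣m*n q)))

  p^-split : ∀ {i s} → i ℕ.≤ s → p ^ s ≡ p ^ (s ∸ i) ℕ.* p ^ i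
  p^-split {i} {s} i≤s = trans (cong (p ^_) (sym (ℕP.m∸n+n≡m i≤s))) (ℕP.^-distribˡ-+-* p (s ∸ i) i)

  p∣p^ : ∀ {k} → 0 ℕ.< k → p ℕD.∣ p ^ k
  p∣p^ {suc k} _ = ℕD.m∣m*n (p ^ k)

  recipDigit∘x^-lower : ∀ {i s w} → i ℕ.< s → (recipDigit ∘x^ (p ^ i)) (p ^ s ℕ.* w) ≡ 0ℤ
  recipDigit∘x^-lower {i} {s} {w} i<s = begin
    (recipDigit ∘x^ (p ^ i)) (p ^ s ℕ.* w)                ≡⟨ cong (recipDigit ∘x^ (p ^ i)) p^s*w≡ ⟩
    (recipDigit ∘x^ (p ^ i)) (p ^ (s ∸ i) ℕ.* w ℕ.* p ^ i) ≡⟨ ∘x^-mult recipDigit (p ^ i) {{p^≢0 i}} (p ^ (s ∸ i) ℕ.* w) ⟩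
    recipDigit (p ^ (s ∸ i) ℕ.* w)                        ≡⟨ recipDigit-p∣ _ (ℕD.∣-trans (p∣p^ (ℕP.m<n⇒0<n∸m i<s)) (ℕD.m∣m*n w)) ⟩
    0ℤ                                                    ∎
    where
    open ≡-Reasoning
    p^s*w≡ : p ^ s ℕ.* w ≡ p ^ (s ∸ i) ℕ.* w ℕ.* p ^ i
    p^s*w≡ = trans (cong (ℕ._* w) (p^-split (ℕP.<⇒≤ i<s))) (regroup (p ^ (s ∸ i)) (p ^ i) w)
      where
      regroup : ∀ a b c → a ℕ.* b ℕ.* c ≡ a ℕ.* c ℕ.* b
      regroup = ℕ-solve-∀

  recipDigit∘x^-higher : ∀ {i s w} → s ℕ.< i → ¬ p ℕD.∣ w → (recipDigit ∘x^ (p ^ i)) (p ^ s ℕ.* w) ≡ 0ℤ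
  recipDigit∘x^-higher {i} {s} {w} s<i p∤w = ∘x^-∤ recipDigit (p ^ i) (p ^ s ℕ.* w) p^i∤p^s*w
    where
    p^i∤p^s*w : ¬ p ^ i ℕD.∣ p ^ s ℕ.* w
    p^i∤p^s*w p^i∣p^s*w = p∤w (ℕD.∣-trans (p∣p^ (ℕP.m<n⇒0<n∸m s<i)) (ℕD.*-cancelˡ-∣ (p ^ s) {{p^≢0 s}}
      (subst (ℕD._∣ p ^ s ℕ.* w) (trans (p^-split (ℕP.<⇒≤ s<i)) (ℕP.*-comm (p ^ (i ∸ s)) (p ^ s))) p^i∣p^s*w)))

  -- Only the term i = s of digitSum survives at n = p^s (n_s + p q), and it equals recipDigit (n_s + p q).
  digitSum-value : ∀ s ns q n → 1 ℕ.≤ ns → ns ℕ.< p → suc n ≡ p ^ s ℕ.* (ns ℕ.+ p ℕ.* q) →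
    digitSum (suc (suc n)) (suc n) ≡ - binomQuot ns
  digitSum-value s ns q n 1≤ns ns<p n≡ = begin
    digitSum (suc (suc n)) (suc n)          ≡⟨ Σ<-single {term} s (suc (suc n)) other-terms s<N ⟩
    (recipDigit ∘x^ (p ^ s)) (suc n)        ≡⟨ cong (recipDigit ∘x^ (p ^ s)) (trans n≡ (ℕP.*-comm (p ^ s) w)) ⟩
    (recipDigit ∘x^ (p ^ s)) (w ℕ.* p ^ s)  ≡⟨ ∘x^-mult recipDigit (p ^ s) {{p^≢0 s}} w ⟩
    - binomQuot (w % p)                     ≡⟨ cong (λ i → - binomQuot i) w%p≡ns ⟩
    - binomQuot ns                          ∎
    where
    open ≡-Reasoning
    w = ns ℕ.+ p ℕ.* q
    term : ℕ → ℤ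
    term i = (recipDigit ∘x^ (p ^ i)) (suc n)
    w%p≡ns : w % p ≡ ns
    w%p≡ns = trans (cong (λ z → (ns ℕ.+ z) % p) (ℕP.*-comm p q)) (trans ([m+kn]%n≡m%n ns q p) (m<n⇒m%n≡m ns<p))
    p^s≤n : p ^ s ℕ.≤ suc n
    p^s≤n = subst (p ^ s ℕ.≤_) (sym n≡) (ℕP.m≤m*n (p ^ s) w {{ℕ.>-nonZero (ℕP.≤-trans 1≤ns (ℕP.m≤m+n ns (p ℕ.* q)))}})
    s<N : s ℕ.< suc (suc n)
    s<N = ℕP.<-≤-trans (n<p^n s) (ℕP.≤-trans p^s≤n (ℕP.n≤1+n (suc n)))
    other-terms : ∀ i → i ≢ s → term i ≡ 0ℤ
    other-terms i i≢s with ℕP.<-cmp i s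
    ... | tri≈ _ i≡s _ = ⊥-elim (i≢s i≡s)
    ... | tri< i<s _ _ = trans (cong (recipDigit ∘x^ (p ^ i)) n≡) (recipDigit∘x^-lower i<s)
    ... | tri> _ _ s<i = trans (cong (recipDigit ∘x^ (p ^ i)) n≡) (recipDigit∘x^-higher s<i (p∤digits ns q 1≤ns ns<p))

  LeadingDigit : ℕ → Set
  LeadingDigit n = Σ[ s ∈ ℕ ] Σ[ ns ∈ ℕ ] Σ[ q ∈ ℕ ] (1 ℕ.≤ ns × ns ℕ.< p × n ≡ p ^ s ℕ.* (ns ℕ.+ p ℕ.* q))

  leadingDigit : ∀ n → 1 ℕ.≤ n → LeadingDigit n
  leadingDigit = <-rec (λ n → 1 ℕ.≤ n → LeadingDigit n) step
    where
    step : ∀ n → (∀ {k} → k ℕ.< n → 1 ℕ.≤ k → LeadingDigit k) → 1 ℕ.≤ n → LeadingDigit n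
    step n rec 1≤n with p ℕD.∣? n
    ... | no p∤n = 0 , n % p , n / p , 1≤n%p , m%n<n n p , n≡
      where
      1≤n%p : 1 ℕ.≤ n % p
      1≤n%p with n % p in n%p≡
      ... | zero = ⊥-elim (p∤n (ℕD.m%n≡0⇒n∣m n p n%p≡))
      ... | suc _ = s≤s z≤n
      n≡ : n ≡ 1 ℕ.* (n % p ℕ.+ p ℕ.* (n / p))
      n≡ = trans (m≡m%n+[m/n]*n n p) (trans (cong (n % p ℕ.+_) (ℕP.*-comm (n / p) p)) (sym (ℕP.*-identityˡ _)))
    ... | yes (ℕD.divides zero n≡0) = ⊥-elim (ℕP.<-irrefl (sym n≡0) 1≤n)
    ... | yes (ℕD.divides (suc k) n≡kp) with rec (subst (suc k ℕ.<_) (sym n≡kp) (ℕP.m<m*n (suc k) p (s≤s (s≤s z≤n)))) (s≤s z≤n)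
    ...   | s , ns , q , 1≤ns , ns<p , k≡ = suc s , ns , q , 1≤ns , ns<p ,
      trans n≡kp (trans (cong (ℕ._* p) k≡) (regroup (p ^ s) (ns ℕ.+ p ℕ.* q) p))
      where
      regroup : ∀ a b c → a ℕ.* b ℕ.* c ≡ c ℕ.* a ℕ.* b
      regroup = ℕ-solve-∀

  leading-*-digitSum≡1 : ∀ s ns q n → 1 ℕ.≤ ns → ns ℕ.< p → suc n ≡ p ^ s ℕ.* (ns ℕ.+ p ℕ.* q) →
    + p ∣ℤ + ns * digitSum (suc (suc n)) (suc n) - 1ℤ
  leading-*-digitSum≡1 s ns q n 1≤ns ns<p n≡ rewrite digitSum-value s ns q n 1≤ns ns<p n≡ =
    subst (+ p ∣ℤ_) (negate (+ ns) (binomQuot ns)) (ℤD.∣m⇒∣-m (binomQuot-inverse ns 1≤ns ns<p))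
    where
    negate : ∀ a b → - (a * b + 1ℤ) ≡ a * - b - 1ℤ
    negate = solve-∀

  p∤digitSum : ∀ n → ¬ + p ∣ℤ digitSum (suc (suc n)) (suc n)
  p∤digitSum n p∣S with leadingDigit (suc n) (s≤s z≤n)
  ... | s , ns , q , 1≤ns , ns<p , n≡ = p∤1 (subst (+ p ∣ℤ_) (cancel (+ ns * digitSum (suc (suc n)) (suc n)))
    (ℤD.∣m∣n⇒∣m-n (ℤD.∣n⇒∣m*n (+ ns) p∣S) (leading-*-digitSum≡1 s ns q n 1≤ns ns<p n≡)))
    where
    cancel : ∀ a → a - (a - 1ℤ) ≡ 1ℤ
    cancel = solve-∀

  p²⁺ᵛ∣p*m*x⇒p∣x : ∀ v m x → Val p v m → + (p ^ (2 ℕ.+ v)) ∣ℤ + p * m * x → + p ∣ℤ x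
  p²⁺ᵛ∣p*m*x⇒p∣x v m x (ℕD.divides c ∣m∣≡cp^v , p^[1+v]∤m) p²⁺ᵛ∣pmx =
    [ ⊥-elim ∘ p∤c , ℤD.∣ᵤ⇒∣ ]′ (euclidsLemma c ∣ x ∣ isPrime p∣c*∣x∣)
    where
    p∤c : ¬ p ℕD.∣ c
    p∤c (ℕD.divides c′ c≡c′p) =
      p^[1+v]∤m (ℕD.divides c′ (trans ∣m∣≡cp^v (trans (cong (ℕ._* p ^ v) c≡c′p) (ℕP.*-assoc c′ p (p ^ v)))))
    ∣pmx∣≡ : ∣ + p * m * x ∣ ≡ p ℕ.* p ^ v ℕ.* (c ℕ.* ∣ x ∣)
    ∣pmx∣≡ = begin
      ∣ + p * m * x ∣               ≡⟨ ℤP.abs-* (+ p * m) x ⟩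
      ∣ + p * m ∣ ℕ.* ∣ x ∣         ≡⟨ cong (ℕ._* ∣ x ∣) (ℤP.abs-* (+ p) m) ⟩
      p ℕ.* ∣ m ∣ ℕ.* ∣ x ∣         ≡⟨ cong (λ a → p ℕ.* a ℕ.* ∣ x ∣) ∣m∣≡cp^v ⟩
      p ℕ.* (c ℕ.* p ^ v) ℕ.* ∣ x ∣ ≡⟨ regroup p c (p ^ v) ∣ x ∣ ⟩
      p ℕ.* p ^ v ℕ.* (c ℕ.* ∣ x ∣) ∎
      where
      open ≡-Reasoning
      regroup : ∀ p c w x → p ℕ.* (c ℕ.* w) ℕ.* x ≡ p ℕ.* w ℕ.* (c ℕ.* x)
      regroup = ℕ-solve-∀
    p∣c*∣x∣ : p ℕD.∣ c ℕ.* ∣ x ∣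
    p∣c*∣x∣ = ℕD.*-cancelˡ-∣ (p ℕ.* p ^ v) {{p^≢0 (suc v)}}
      (subst₂ ℕD._∣_ (ℕP.*-comm p (p ℕ.* p ^ v)) ∣pmx∣≡ (ℤD.∣⇒∣ᵤ p²⁺ᵛ∣pmx))

  d≡p*m*u : ∀ m → m ≢ 0ℤ → (n : ℕ) → 1 ℕ.≤ n →
    (s ns q : ℕ) → 1 ℕ.≤ ns → ns ℕ.< p → n ≡ p ^ s ℕ.* (ns ℕ.+ p ℕ.* q) →
    (u : ℕ) → 1 ℕ.≤ u → u ℕ.< p → p ℕD.∣ ∣ + (ns ℕ.* u) - 1ℤ ∣ →
    (v : ℕ) → Val p v m → d p m n ≡ + p * m * + u [mod p ^ (2 ℕ.+ v) ]
  d≡p*m*u m m≢0 (suc n) _ s ns q 1≤ns ns<p n≡ u _ _ p∣ns*u-1 v (p^v∣m , _) =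
    ℤD.∣⇒∣ᵤ {+ (p ^ (2 ℕ.+ v))} {d p m (suc n) - + p * m * + u} d≡pmu
    where
    S = digitSum (suc (suc n)) (suc n)
    p∣ns*[S-u] : + p ∣ℤ + ns * (S - + u)
    p∣ns*[S-u] = subst (+ p ∣ℤ_) (sym (split (+ ns) S (+ u)))
      (ℤD.∣m∣n⇒∣m-n (leading-*-digitSum≡1 s ns q n 1≤ns ns<p n≡)
                    (subst (λ a → + p ∣ℤ a - 1ℤ) (ℤP.pos-* ns u) (ℤD.∣ᵤ⇒∣ {+ p} {+ (ns ℕ.* u) - 1ℤ} p∣ns*u-1)))
      where
      split : ∀ a b c → a * (b - c) ≡ (a * b - 1ℤ) - (a * c - 1ℤ)
      split = solve-∀
    p∣S-u : + p ∣ℤ S - + u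
    p∣S-u = [ ⊥-elim ∘ p∤digit ns 1≤ns ns<p , (λ p∣S-u → p∣S-u) ]′ (p∣ℤ-*⇒ (+ ns) (S - + u) p∣ns*[S-u])
    d≡pmu : d p m (suc n) ≡ + p * m * + u [modℤ p ^ (2 ℕ.+ v) ]
    d≡pmu = ≡mod-p*m* v m (d p m (suc n)) S (+ u) (ℤD.∣ᵤ⇒∣ {+ (p ^ v)} {m} p^v∣m) p∣S-u
                      (d≡p*m*digitSum m m≢0 n v p^v∣m)

  invPow-≡1-mod-x : ∀ K m → invPow K m ≡1-mod-x^ 1
  invPow-≡1-mod-x K (+ e) = ≡1-mod-x^-pow e λ { zero _ → geom-∣ K 0 (ℕD._∣0 K) ; (suc _) (s≤s ()) }
  invPow-≡1-mod-x K -[1+ j ] = ≡1-mod-x^-pow (suc j) λ { zero _ → refl ; (suc _) (s≤s ()) }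

  prodTo-≡1-mod-x : ∀ m N → prodTo p m N ≡1-mod-x^ 1
  prodTo-≡1-mod-x m zero _ _ = refl
  prodTo-≡1-mod-x m (suc N) = ≡1-mod-x^-⊛ (prodTo-≡1-mod-x m N) (invPow-≡1-mod-x (p ^ N) (+ (p ∸ 1) * m))

  d-at-0 : ∀ m → d p m 0 ≡ 1ℤ
  d-at-0 m = ≡1-mod-x^-⊛ (invPow-≡1-mod-x 1 m) (prodTo-≡1-mod-x m 1) 0 (s≤s z≤n)

  val-d-at-0 : ∀ m → Val p 0 (d p m 0)
  val-d-at-0 m rewrite d-at-0 m =
    ℕD.∣-refl , λ p∣1 → ℕP.<⇒≱ (s≤s (s≤s z≤n)) (ℕD.∣⇒≤ (subst (ℕD._∣ 1) (ℕP.*-identityʳ p) p∣1))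

  val-d : ∀ m → m ≢ 0ℤ → (n : ℕ) → 1 ℕ.≤ n → (v : ℕ) → Val p v m → Val p (suc v) (d p m n)
  val-d m m≢0 (suc n) _ v val@(p^v∣m , _) = ℤD.∣⇒∣ᵤ p^[1+v]∣d , p²⁺ᵛ∤d
    where
    S = digitSum (suc (suc n)) (suc n)
    D = d p m (suc n)
    D≡pmS = d≡p*m*digitSum m m≢0 n v p^v∣m
    p^[1+v]∣pmS : + (p ^ suc v) ∣ℤ + p * m * S
    p^[1+v]∣pmS = ℤD.∣m⇒∣m*n S (subst (_∣ℤ + p * m) (sym (ℤP.pos-* p (p ^ v))) (ℤD.*-monoʳ-∣ (+ p) (ℤD.∣ᵤ⇒∣ p^v∣m)))
    p^[1+v]∣d : + (p ^ suc v) ∣ℤ D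
    p^[1+v]∣d = subst (+ (p ^ suc v) ∣ℤ_) (restore D (+ p * m * S))
      (ℤD.∣m∣n⇒∣m+n (ℤD.∣-trans (ℤD.∣ᵤ⇒∣ {+ (p ^ suc v)} {+ (p ^ (2 ℕ.+ v))} (ℕD.n∣m*n p)) D≡pmS) p^[1+v]∣pmS)
      where
      restore : ∀ a b → (a - b) + b ≡ a
      restore = solve-∀
    p²⁺ᵛ∤d : ¬ p ^ (2 ℕ.+ v) ℕD.∣ ∣ D ∣
    p²⁺ᵛ∤d p²⁺ᵛ∣d = p∤digitSum n (p²⁺ᵛ∣p*m*x⇒p∣x v m S val
      (subst (+ (p ^ (2 ℕ.+ v)) ∣ℤ_) (cancel D (+ p * m * S)) (ℤD.∣m∣n⇒∣m-n (ℤD.∣ᵤ⇒∣ {+ (p ^ (2 ℕ.+ v))} {D} p²⁺ᵛ∣d) D≡pmS)))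
      where
      cancel : ∀ a b → a - (a - b) ≡ b
      cancel = solve-∀

  d/pm-independent : ∀ m → m ≢ 0ℤ → (m′ : ℤ) → m′ ≢ 0ℤ → (n : ℕ) → 1 ℕ.≤ n → (ρ : ℤ) → (v v′ : ℕ) →
    Val p v m → Val p v′ m′ →
    d p m n ≡ + p * m * ρ [mod p ^ (2 ℕ.+ v) ] → d p m′ n ≡ + p * m′ * ρ [mod p ^ (2 ℕ.+ v′) ]
  d/pm-independent m m≢0 m′ m′≢0 (suc n) _ ρ v v′ val (p^v′∣m′ , _) d≡pmρ =
    ℤD.∣⇒∣ᵤ (≡mod-p*m* v′ m′ (d p m′ (suc n)) S ρ (ℤD.∣ᵤ⇒∣ {+ (p ^ v′)} {m′} p^v′∣m′) p∣S-ρ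
                        (d≡p*m*digitSum m′ m′≢0 n v′ p^v′∣m′))
    where
    S = digitSum (suc (suc n)) (suc n)
    p∣ρ-S : + p ∣ℤ ρ - S
    p∣ρ-S = p²⁺ᵛ∣p*m*x⇒p∣x v m (ρ - S) val
      (subst (+ (p ^ (2 ℕ.+ v)) ∣ℤ_) (difference (d p m (suc n)) (+ p) m ρ S)
        (ℤD.∣m∣n⇒∣m-n (d≡p*m*digitSum m m≢0 n v (proj₁ val))
                      (ℤD.∣ᵤ⇒∣ {+ (p ^ (2 ℕ.+ v))} {d p m (suc n) - + p * m * ρ} d≡pmρ)))
      where
      difference : ∀ a P M x y → (a - P * M * y) - (a - P * M * x) ≡ P * M * (x - y)
      difference = solve-∀
    p∣S-ρ : + p ∣ℤ S - ρ
    p∣S-ρ = subst (+ p ∣ℤ_) (flip ρ S) (ℤD.∣m⇒∣-m p∣ρ-S)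
      where
      flip : ∀ a b → - (a - b) ≡ b - a
      flip = solve-∀


open import Defs
open import Data.Nat as ℕ using (ℕ; suc; _≤_; _<_; _^_; s≤s)
open import Data.Integer using (ℤ; +_; _*_; _-_; 1ℤ; 0ℤ)
open import Data.Integer.Divisibility using (_∣_)
open import Data.Product using (_×_; _,_)
open import Relation.Binary.PropositionalEquality using (_≡_; _≢_)

corollary4p4 : (p : ℕ) → Prime p → 3 ≤ p → (m : ℤ) → m ≢ 0ℤ →
    -- main congruence: n = n_s p^s + (higher digits) with 0 < n_s < p, u = inverse of n_s mod p in 1..p-1
    ((n : ℕ) → 1 ≤ n → (s ns q : ℕ) → 1 ≤ ns → ns < p → n ≡ p ^ s ℕ.* (ns ℕ.+ p ℕ.* q) →
      (u : ℕ) → 1 ≤ u → u < p → (+ p) ∣ (+ (ns ℕ.* u) - 1ℤ) →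
      (v : ℕ) → Val p v m →
      d p m n ≡ + p * m * + u [mod p ^ (2 ℕ.+ v) ])
    ×
    -- ν_p(d_m(0)) = 0
    Val p 0 (d p m 0)
    ×
    -- ν_p(d_m(n)) = ν_p(m) + 1 for n ≥ 1
    ((n : ℕ) → 1 ≤ n → (v : ℕ) → Val p v m → Val p (suc v) (d p m n))
    ×
    -- (d_m(n)/(pm) mod p) for n ≥ 1 does not depend on m
    ((m′ : ℤ) → m′ ≢ 0ℤ → (n : ℕ) → 1 ≤ n → (r : ℤ) → (v v′ : ℕ) → Val p v m → Val p v′ m′ →
      d p m n ≡ + p * m * r [mod p ^ (2 ℕ.+ v) ] →
      d p m′ n ≡ + p * m′ * r [mod p ^ (2 ℕ.+ v′) ])
corollary4p4 (suc (suc (suc r))) isPrime (s≤s (s≤s (s≤s _))) m m≢0 =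
  d≡p*m*u m m≢0 , val-d-at-0 m , val-d m m≢0 , d/pm-independent m m≢0
  where open OddPrime r isPrime
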